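{- Let $p$ be an acceptable prime for a strong divisibility sequence $C$, with an integer $s(p)\ge1$ as in the definition of acceptable, and let $k\ge2$ be an integer. For any integer $n\ge0$, write $n=\alpha(p^{s(p)})n'+r$ with $n'\in\mathbb N$ and $0\le r<\alpha(p^{s(p)})$. Then \[ \sum_{\substack{\mathbf m\in\mathbb N^k\\ \operatorname{tot}\mathbf m=n}}x^{\nu_p\left(\binom{n}{m_1,\dots,m_k}_C\right)}=\sum_{\lambda=0}^{k-1}u_{p,k,C,\lambda}(r)\,T_{p,k,\lambda}(n',x), \] where \[ u_{p,k,C,\lambda}(r)=\sum_{\substack{\mathbf r=(r_1,\dots,r_k)\in\{0,1,\dots,\alpha(p^{s(p)})-1\}^k\\ r_1+\cdots+r_k=r+\lambda\alpha(p^{s(p)})}}x^{f_{p,k,C,\lambda}(r,\mathbf r)-\lambda}, \] \[ f_{p,k,C,\lambda}(r,\mathbf r)=\lambda\sum_{j=1}^{s(p)}\frac{\alpha(p^{s(p)})}{\alpha(p^j)}+\sum_{j=1}^{s(p)}\left(\left\lfloor\frac{r}{\alpha(p^j)}\right\rfloor-\sum_{i=1}^k\left\lfloor\frac{r_i}{\alpha(p^j)}\right\rfloor\right). \]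
   Context: A strong divisibility sequence is a sequence $C=C_1,C_2,\dots$ of nonzero integers with $\gcd(C_n,C_m)=C_{\gcd(n,m)}$ for all positive $n,m$. The $C$-orial is $0!_C=1$, $n!_C=C_nC_{n-1}\cdots C_1$ for $n\ge1$. For $\mathbf m=(m_1,\dots,m_k)\in\mathbb N^k$ ($\mathbb N$ includes $0$) write $\operatorname{tot}\mathbf m=m_1+\cdots+m_k$; for $\operatorname{tot}\mathbf m=n$, $\binom{n}{m_1,\dots,m_k}_C=\frac{n!_C}{m_1!_C\cdots m_k!_C}$ and $\binom{n}{m_1,\dots,m_k}=\frac{n!}{m_1!\cdots m_k!}$. $\nu_p$ is the $p$-adic valuation. Let $T_{p,k}(n,x)=\sum_{\mathbf m\in\mathbb N^k,\ \operatorname{tot}\mathbf m=n}x^{\nu_p(\binom{n}{m_1,\dots,m_k})}$, and for $0\le\lambda\le k-1$ let $T_{p,k,\lambda}(n,x)=0$ if $0\le n\le\lambda-1$ and $T_{p,k,\lambda}(n,x)=x^{\nu_p\left(\frac{n!}{(n-\lambda)!}\right)+\lambda}T_{p,k}(n-\lambda,x)$ if $n\ge\lambda$. The rank of apparition $\alpha(m)$ is the least index $j\ge1$ with $m\mid C_j$ (if it exists). When $\alpha(p^k)$ exists for all $k\ge1$, set $a_k(p)=\alpha(p^k)/\alpha(p^{k-1})$ for $k\ge2$. The prime $p$ is acceptable for $C$ if $\alpha(p^k)$ exists for all $k\ge1$ and there is an integer $s(p)\ge1$ such that $a_k(p)$ is a (positive) integer for $2\le k\le s(p)$ and $a_k(p)=p$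 for $k>s(p)$. -}

module Defs where

open import Data.Bool using (Bool; true; false; if_then_else_; _∧_; not)
open import Data.Nat using (ℕ; zero; suc; _+_; _*_; _∸_; _^_; _≤_; _<_; _≤?_; _≟_)
open import Data.Nat.DivMod using (_/_)
open import Data.Nat.Divisibility using (_∣_; _∣?_)
open import Data.Nat using (_!)
open import Data.Nat.GCD using (gcd)
open import Data.Integer as ℤ using (ℤ; +_; ∣_∣)
import Data.Integer.GCD as ℤG
open import Data.List using (List; []; _∷_; [_]; map; concatMap; upTo; filter)
open import Data.Nat.ListAction using (sum)
open import Data.Vec using (Vec; []; _∷_)
import Data.Vec as V
open import Data.Product using (_×_)
open import Relation.Nullary using (¬_; does)
open import Relation.Binary.PropositionalEquality using (_≡_)

divN : ℕ → ℕ → ℕ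
divN a zero = 0
divN a (suc b) = a / suc b

-- p-adic valuation of a natural number m (for p ≥ 2, m ≥ 1: the largest e
-- with p ^ e ∣ m).  Computed with fuel m, which suffices since p ^ e ≤ m.
-- (Convention: value 0 when m = 0 or p < 2; never used in those cases.)
nuFuel : ℕ → ℕ → ℕ → ℕ
nuFuel zero p m = 0
nuFuel (suc f) p m =
  if does (2 ≤? p) ∧ not (does (m ≟ 0)) ∧ does (p ∣? m)
  then suc (nuFuel f p (divN m p))
  else 0

ν : ℕ → ℕ → ℕ
ν p m = nuFuel m p m

νℤ : ℕ → ℤ → ℕ
νℤ p z = ν p ∣ z ∣

-- Strong divisibility sequence C₁, C₂, …  (C : ℕ → ℤ, index 0 unused).
-- gcd of integers is the nonnegative gcd, so the condition is read up to sign.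
IsStrongDivSeq : (ℕ → ℤ) → Set
IsStrongDivSeq C =
  ((n : ℕ) → 1 ≤ n → ¬ (C n ≡ + 0)) ×
  ((n m : ℕ) → 1 ≤ n → 1 ≤ m → ℤG.gcd (C n) (C m) ≡ + ∣ C (gcd n m) ∣)

IsRankOfApparition : (ℕ → ℤ) → ℕ → ℕ → Set
IsRankOfApparition C m j =
  1 ≤ j × (m ∣ ∣ C j ∣) × ((i : ℕ) → 1 ≤ i → i < j → ¬ (m ∣ ∣ C i ∣))

-- p is acceptable for C, witnessed by α e = α(p^e) (e ≥ 1) and s = s(p) ≥ 1.
IsAcceptable : (ℕ → ℤ) → ℕ → (ℕ → ℕ) → ℕ → Set
IsAcceptable C p α s =
  ((e : ℕ) → 1 ≤ e → IsRankOfApparition C (p ^ e) (α e)) ×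
  1 ≤ s ×
  ((e : ℕ) → 2 ≤ e → e ≤ s → α (e ∸ 1) ∣ α e) ×
  ((e : ℕ) → s < e → α e ≡ p * α (e ∸ 1))

orialC : (ℕ → ℤ) → ℕ → ℤ
orialC C zero = + 1
orialC C (suc n) = C (suc n) ℤ.* orialC C n

allVecs : (k B : ℕ) → List (Vec ℕ k)
allVecs zero B = [ [] ]
allVecs (suc k) B = concatMap (λ i → map (i ∷_) (allVecs k B)) (upTo B)

tot : {k : ℕ} → Vec ℕ k → ℕ
tot = V.sum

-- All m ∈ ℕ^k with tot m = n (each entry is then ≤ n).
compositions : (k n : ℕ) → List (Vec ℕ k)
compositions k n = filter (λ v → tot v ≟ n) (allVecs k (suc n))

-- C-multinomial n!_C / (m₁!_C ⋯ m_k!_C) (n = tot m), as an integer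
-- (it is an integer for strong divisibility sequences; computed on absolute values).
multinomialC : (ℕ → ℤ) → {k : ℕ} → Vec ℕ k → ℕ
multinomialC C m =
  divN ∣ orialC C (tot m) ∣ ∣ V.foldr _ (λ a acc → orialC C a ℤ.* acc) (+ 1) m ∣

multinomial : {k : ℕ} → Vec ℕ k → ℕ
multinomial m = divN (tot m !) (V.foldr _ (λ a acc → (a !) * acc) 1 m)

Σ-list : {A : Set} → List A → (A → ℕ) → ℕ
Σ-list xs g = sum (map g xs)

Σ-range : ℕ → ℕ → (ℕ → ℕ) → ℕ
Σ-range a b g = sum (map (λ i → g (a + i)) (upTo (suc b ∸ a)))

Σℤ-range : ℕ → ℕ → (ℕ → ℤ) → ℤ
Σℤ-range a b g = Data.List.foldr ℤ._+_ (+ 0) (map (λ i → g (a + i)) (upTo (suc b ∸ a)))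

T : (p k n x : ℕ) → ℕ
T p k n x = Σ-list (compositions k n) (λ m → x ^ ν p (multinomial m))

Tλ : (p k λ' n x : ℕ) → ℕ
Tλ p k λ' n x with n Data.Nat.<? λ'
... | Relation.Nullary.yes _ = 0
... | Relation.Nullary.no _ =
  x ^ (ν p (divN (n !) ((n ∸ λ') !)) + λ') * T p k (n ∸ λ') x

fpkC : (α : ℕ → ℕ) (s k λ' r : ℕ) → Vec ℕ k → ℤ
fpkC α s k λ' r rs =
  + (λ' * Σ-range 1 s (λ j → divN (α s) (α j)))
  ℤ.+ Σℤ-range 1 s (λ j →
        + divN r (α j) ℤ.- + V.sum (V.map (λ ri → divN ri (α j)) rs))

-- u_{p,k,C,λ}(r), evaluated at x.  The exponent f - λ is always ≥ 0; it is taken as the natural number ∣ f - λ ∣.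
u : (α : ℕ → ℕ) (s k λ' r x : ℕ) → ℕ
u α s k λ' r x =
  Σ-list (filter (λ v → tot v ≟ r + λ' * α s) (allVecs k (α s)))
         (λ rs → x ^ ∣ fpkC α s k λ' r rs ℤ.- + λ' ∣)

LHS : (C : ℕ → ℤ) (p k n x : ℕ) → ℕ
LHS C p k n x = Σ-list (compositions k n) (λ m → x ^ ν p (multinomialC C m))

-- Write A = α(p^s). Every composition m of n = A n′ + r₀ splits uniquely as mᵢ = A qᵢ + rᵢ with
-- 0 ≤ rᵢ < A; then r₁ + ⋯ + r_k = r₀ + λA for a carry λ < k, and q is a composition of n′ − λ.
-- By strong divisibility the indices i with p^e ∣ C_i are exactly the multiples of α(p^e), so
-- Legendre's counting argument gives ν_p(m!_C) = ∑_{j ≤ s} ⌊m / α(p^j)⌋ + ν_p(⌊m / A⌋!), the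
-- levels above s contributing the ordinary Legendre sum because α(p^{s+t}) = p^t A.
-- Substituted into the C-multinomial of m, this splits its exponent into f − λ, which depends on r
-- only, plus ν_p(n′! / (n′ − λ)!) + λ and ν_p of the ordinary multinomial of q; summing over q gives
-- T_{p,k,λ}(n′) and summing over r gives u(r₀). The same counting makes m ↦ #{i ≤ m : d ∣ C_i}
-- superadditive, so C-multinomials are integers and their valuations are differences of valuations.

module Submission where

open import Defs
open import Data.Nat using (ℕ; _+_; _*_; _≤_; _<_)
open import Data.Nat.Primality using (Prime)
open import Data.Integer using (ℤ)
open import Relation.Binary.PropositionalEquality using (_≡_)

open import Data.Nat using (zero; suc; _∸_; _^_; _≟_; _<?_; _≤?_; z≤n; s≤s; z<s; s<s; >-nonZero; nonTrivial⇒n>1; _!)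
open import Data.Nat.Properties
open import Data.Nat.DivMod
open import Data.Nat.Divisibility
open import Data.Nat.Solver using (module +-*-Solver)
import Data.Integer as ℤ
import Data.Integer.Properties as ℤ
import Data.Integer.Solver as ℤ
open import Data.Nat.Primality using (euclidsLemma; prime⇒nonZero; prime⇒nonTrivial; productOfPrimes≥1)
open import Data.Nat.Primality.Factorisation using (factorise; PrimeFactorisation)
open import Data.Nat.ListAction using (product)
open import Data.Nat.Combinatorics using (k![n∸k]!∣n!)
open import Data.Nat.GCD using (gcd; gcd[m,n]∣m; gcd[m,n]∣n; gcd-greatest; gcd[m,n]≢0)
import Data.List.Relation.Unary.All as List
open import Data.Bool using (true; false; _∧_; not)
open import Relation.Nullary.Decidable using (dec-true; dec-false)
open import Data.Product using (Σ; _×_; _,_; proj₁; proj₂)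
open import Data.Sum using (_⊎_; inj₁; inj₂; [_,_]′)
open import Data.Empty using (⊥; ⊥-elim)
open import Data.Vec using (Vec; []; _∷_)
import Data.Vec as V
open import Data.Vec.Relation.Unary.All using (All; []; _∷_)
open import Data.List using (List; []; _∷_; _++_; concatMap; applyUpTo; upTo)
import Data.List as L
open import Function using (_∘_)
open import Relation.Nullary using (¬_; Dec; yes; no; does)
open import Relation.Binary.PropositionalEquality
  using (_≢_; refl; sym; trans; cong; cong₂; subst; module ≡-Reasoning)

open +-*-Solver using (solve; _:+_; _:*_; _:=_)
open ℤ.+-*-Solver using () renaming (solve to solveℤ; _:+_ to _⊕_; _:-_ to _⊝_; _:=_ to _≐_)

∑ : ℕ → (ℕ → ℕ) → ℕ
∑ zero    f = 0
∑ (suc n) f = f 0 + ∑ n (f ∘ suc)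

syntax ∑ n (λ i → e) = ∑[ i < n ] e

∑-cong : ∀ n {f g : ℕ → ℕ} → (∀ i → i < n → f i ≡ g i) → ∑ n f ≡ ∑ n g
∑-cong zero    eq = refl
∑-cong (suc n) eq = cong₂ _+_ (eq 0 z<s) (∑-cong n (λ i i<n → eq (suc i) (s<s i<n)))

∑-zero : ∀ n {f : ℕ → ℕ} → (∀ i → i < n → f i ≡ 0) → ∑ n f ≡ 0
∑-zero zero    eq = refl
∑-zero (suc n) eq = cong₂ _+_ (eq 0 z<s) (∑-zero n (λ i i<n → eq (suc i) (s<s i<n)))

∑-0 : ∀ n → ∑[ i < n ] 0 ≡ 0
∑-0 n = ∑-zero n (λ _ _ → refl)

∑-+ : ∀ n (f g : ℕ → ℕ) → ∑[ i < n ] (f i + g i) ≡ ∑ n f + ∑ n g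
∑-+ zero    f g = refl
∑-+ (suc n) f g = trans (cong (f 0 + g 0 +_) (∑-+ n (f ∘ suc) (g ∘ suc)))
  (solve 4 (λ a b c d → (a :+ b) :+ (c :+ d) := (a :+ c) :+ (b :+ d)) refl (f 0) (g 0) _ _)

∑-*ˡ : ∀ n c (f : ℕ → ℕ) → ∑[ i < n ] (c * f i) ≡ c * ∑ n f
∑-*ˡ zero    c f = sym (*-zeroʳ c)
∑-*ˡ (suc n) c f = trans (cong (c * f 0 +_) (∑-*ˡ n c (f ∘ suc))) (sym (*-distribˡ-+ c (f 0) _))

∑-split : ∀ m n (f : ℕ → ℕ) → ∑ (m + n) f ≡ ∑ m f + ∑[ i < n ] f (m + i)
∑-split zero    n f = refl
∑-split (suc m) n f = trans (cong (f 0 +_) (∑-split m n (f ∘ suc))) (sym (+-assoc (f 0) _ _))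

∑-last : ∀ n (f : ℕ → ℕ) → ∑ (suc n) f ≡ ∑ n f + f n
∑-last zero    f = +-comm (f 0) 0
∑-last (suc n) f = trans (cong (f 0 +_) (∑-last n (f ∘ suc))) (sym (+-assoc (f 0) _ _))

∑-comm : ∀ m n (f : ℕ → ℕ → ℕ) → ∑[ i < m ] ∑ n (f i) ≡ ∑[ j < n ] ∑[ i < m ] f i j
∑-comm zero    n f = sym (∑-0 n)
∑-comm (suc m) n f = trans (cong (∑ n (f 0) +_) (∑-comm m n (f ∘ suc)))
                           (sym (∑-+ n (f 0) (λ j → ∑[ i < m ] f (suc i) j)))

∑-sum-comm : ∀ {k} E (g : ℕ → ℕ → ℕ) (w : Vec ℕ k) →
             ∑[ e < E ] V.sum (V.map (λ x → g x e) w) ≡ V.sum (V.map (λ x → ∑ E (g x)) w)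
∑-sum-comm E g []      = ∑-0 E
∑-sum-comm E g (x ∷ w) = trans (∑-+ E (g x) _) (cong (∑ E (g x) +_) (∑-sum-comm E g w))

∑-blocks : ∀ a Q (f : ℕ → ℕ) → ∑ (a * Q) f ≡ ∑[ q < Q ] ∑[ r < a ] f (a * q + r)
∑-blocks a zero    f = cong (λ m → ∑ m f) (*-zeroʳ a)
∑-blocks a (suc Q) f = begin
  ∑ (a * suc Q) f
    ≡⟨ cong (λ m → ∑ m f) (*-suc a Q) ⟩
  ∑ (a + a * Q) f
    ≡⟨ ∑-split a (a * Q) f ⟩
  ∑ a f + ∑[ i < a * Q ] f (a + i)
    ≡⟨ cong₂ _+_ (∑-cong a (λ r _ → cong (λ z → f (z + r)) (sym (*-zeroʳ a))))
                 (trans (∑-blocks a Q (λ i → f (a + i))) (∑-cong Q (λ q _ → ∑-cong a (λ r _ → cong f (shift q r))))) ⟩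
  ∑[ r < a ] f (a * 0 + r) + ∑[ q < Q ] ∑[ r < a ] f (a * suc q + r)
    ∎
  where
  open ≡-Reasoning
  shift : ∀ q r → a + (a * q + r) ≡ a * suc q + r
  shift q r = trans (sym (+-assoc a _ r)) (cong (_+ r) (sym (*-suc a q)))

∑-vanishing-tail : ∀ B B' (f : ℕ → ℕ) → (∀ i → B ≤ i → f i ≡ 0) → B ≤ B' → ∑ B' f ≡ ∑ B f
∑-vanishing-tail B B' f tail B≤B' = begin
  ∑ B' f                                 ≡⟨ cong (λ m → ∑ m f) (sym (m+[n∸m]≡n B≤B')) ⟩
  ∑ (B + (B' ∸ B)) f                     ≡⟨ ∑-split B (B' ∸ B) f ⟩
  ∑ B f + ∑[ i < B' ∸ B ] f (B + i)      ≡⟨ cong (∑ B f +_) (∑-zero (B' ∸ B) (λ i _ → tail (B + i) (m≤m+n B i))) ⟩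
  ∑ B f + 0                              ≡⟨ +-identityʳ _ ⟩
  ∑ B f                                  ∎
  where open ≡-Reasoning

∑-single : ∀ n c (f : ℕ → ℕ) → c < n → (∀ i → i < n → i ≢ c → f i ≡ 0) → ∑ n f ≡ f c
∑-single (suc n) zero f _ others =
  trans (cong (f 0 +_) (∑-zero n (λ i i<n → others (suc i) (s<s i<n) (λ ())))) (+-identityʳ _)
∑-single (suc n) (suc c) f (s≤s c<n) others =
  trans (cong (_+ ∑ n (f ∘ suc)) (others 0 z<s (λ ())))
        (∑-single n c (f ∘ suc) c<n (λ i i<n i≢c → others (suc i) (s<s i<n) (i≢c ∘ suc-injective)))

∑-≤-term : ∀ n (f : ℕ → ℕ) i → i < n → f i ≤ ∑ n f
∑-≤-term (suc n) f zero    _         = m≤m+n (f 0) _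
∑-≤-term (suc n) f (suc i) (s≤s i<n) = ≤-trans (∑-≤-term n (f ∘ suc) i i<n) (m≤n+m _ (f 0))

∑-mono-≤ : ∀ n {f g : ℕ → ℕ} → (∀ i → i < n → f i ≤ g i) → ∑ n f ≤ ∑ n g
∑-mono-≤ zero    le = z≤n
∑-mono-≤ (suc n) le = +-mono-≤ (le 0 z<s) (∑-mono-≤ n (λ i i<n → le (suc i) (s<s i<n)))

∑-indicator-prefix : ∀ n v (f : ℕ → ℕ) → v ≤ n →
                     (∀ i → i < v → f i ≡ 1) → (∀ i → v ≤ i → f i ≡ 0) → ∑ n f ≡ v
∑-indicator-prefix n       zero    f _         _    zeros = ∑-zero n (λ i _ → zeros i z≤n)
∑-indicator-prefix (suc n) (suc v) f (s≤s v≤n) ones zeros =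
  cong₂ _+_ (ones 0 z<s)
            (∑-indicator-prefix n v (f ∘ suc) v≤n (λ i i<v → ones (suc i) (s<s i<v)) (λ i v≤i → zeros (suc i) (s≤s v≤i)))

∑ⱽ : ∀ k → ℕ → (Vec ℕ k → ℕ) → ℕ
∑ⱽ zero    B h = h []
∑ⱽ (suc k) B h = ∑[ i < B ] ∑ⱽ k B (λ w → h (i ∷ w))

∑ⱽ-cong : ∀ k B {g h : Vec ℕ k → ℕ} → (∀ w → All (_< B) w → g w ≡ h w) → ∑ⱽ k B g ≡ ∑ⱽ k B h
∑ⱽ-cong zero    B eq = eq [] []
∑ⱽ-cong (suc k) B eq = ∑-cong B (λ i i<B → ∑ⱽ-cong k B (λ w w<B → eq (i ∷ w) (i<B ∷ w<B)))

∑ⱽ-zero : ∀ k B {h : Vec ℕ k → ℕ} → (∀ w → All (_< B) w → h w ≡ 0) → ∑ⱽ k B h ≡ 0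
∑ⱽ-zero zero    B eq = eq [] []
∑ⱽ-zero (suc k) B eq = ∑-zero B (λ i i<B → ∑ⱽ-zero k B (λ w w<B → eq (i ∷ w) (i<B ∷ w<B)))

∑ⱽ-0 : ∀ k B → ∑ⱽ k B (λ _ → 0) ≡ 0
∑ⱽ-0 k B = ∑ⱽ-zero k B (λ _ _ → refl)

∑ⱽ-*ˡ : ∀ k B c (h : Vec ℕ k → ℕ) → ∑ⱽ k B (λ w → c * h w) ≡ c * ∑ⱽ k B h
∑ⱽ-*ˡ zero    B c h = refl
∑ⱽ-*ˡ (suc k) B c h = trans (∑-cong B (λ i _ → ∑ⱽ-*ˡ k B c _)) (∑-*ˡ B c _)

∑ⱽ-*ʳ : ∀ k B c (h : Vec ℕ k → ℕ) → ∑ⱽ k B (λ w → h w * c) ≡ ∑ⱽ k B h * c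
∑ⱽ-*ʳ k B c h = trans (∑ⱽ-cong k B (λ w _ → *-comm (h w) c)) (trans (∑ⱽ-*ˡ k B c h) (*-comm c _))

∑ⱽ-+ : ∀ k B (g h : Vec ℕ k → ℕ) → ∑ⱽ k B (λ w → g w + h w) ≡ ∑ⱽ k B g + ∑ⱽ k B h
∑ⱽ-+ zero    B g h = refl
∑ⱽ-+ (suc k) B g h = trans (∑-cong B (λ i _ → ∑ⱽ-+ k B _ _)) (∑-+ B _ _)

∑ⱽ-∑-comm : ∀ k B n (g : ℕ → Vec ℕ k → ℕ) → ∑ⱽ k B (λ w → ∑[ l < n ] g l w) ≡ ∑[ l < n ] ∑ⱽ k B (g l)
∑ⱽ-∑-comm k B zero    g = ∑ⱽ-0 k B
∑ⱽ-∑-comm k B (suc n) g = trans (∑ⱽ-+ k B (g 0) (λ w → ∑[ l < n ] g (suc l) w))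
                           (cong (∑ⱽ k B (g 0) +_) (∑ⱽ-∑-comm k B n (g ∘ suc)))

∑ⱽ-vanishing-tail : ∀ k n B B' (h : Vec ℕ k → ℕ) → (∀ w → n < tot w → h w ≡ 0) → n < B → B ≤ B' →
                    ∑ⱽ k B' h ≡ ∑ⱽ k B h
∑ⱽ-vanishing-tail zero    n B B' h _     _   _     = refl
∑ⱽ-vanishing-tail (suc k) n B B' h large n<B B≤B' = begin
  ∑[ i < B' ] ∑ⱽ k B' (λ w → h (i ∷ w))   ≡⟨ ∑-cong B' (λ i _ → ∑ⱽ-vanishing-tail k (n ∸ i) B B' _ (large-tail i)
                                                                   (≤-trans (s≤s (m∸n≤m n i)) n<B) B≤B') ⟩
  ∑[ i < B' ] ∑ⱽ k B (λ w → h (i ∷ w))    ≡⟨ ∑-vanishing-tail B B' _ (λ i B≤i → ∑ⱽ-zero k B (λ w _ →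
                                                large (i ∷ w) (≤-trans (≤-trans n<B B≤i) (m≤m+n i (tot w))))) B≤B' ⟩
  ∑[ i < B ] ∑ⱽ k B (λ w → h (i ∷ w))     ∎
  where
  open ≡-Reasoning
  large-tail : ∀ i w → n ∸ i < tot w → h (i ∷ w) ≡ 0
  large-tail i w lt = large (i ∷ w) (≤-trans (s≤s (m≤n+m∸n n i)) (+-monoʳ-< i lt))

scaleAdd : ∀ {k} → ℕ → Vec ℕ k → Vec ℕ k → Vec ℕ k
scaleAdd a = V.zipWith (λ q r → a * q + r)

tot-scaleAdd : ∀ {k} a (q r : Vec ℕ k) → tot (scaleAdd a q r) ≡ a * tot q + tot r
tot-scaleAdd a []      []      = cong (_+ 0) (sym (*-zeroʳ a))
tot-scaleAdd a (x ∷ q) (y ∷ r) = trans (cong (a * x + y +_) (tot-scaleAdd a q r))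
  (solve 5 (λ a x y tq tr → (a :* x :+ y) :+ (a :* tq :+ tr) := a :* (x :+ tq) :+ (y :+ tr)) refl a x y (tot q) (tot r))

tot-scaleAdd-carry : ∀ {k} a (q r : Vec ℕ k) {l r₀ n} → tot r ≡ r₀ + l * a → tot q + l ≡ n →
                     tot (scaleAdd a q r) ≡ a * n + r₀
tot-scaleAdd-carry a q r {l} {r₀} {n} tot-r≡ tot-q+l≡ = begin
  tot (scaleAdd a q r)         ≡⟨ tot-scaleAdd a q r ⟩
  a * tot q + tot r            ≡⟨ cong (a * tot q +_) tot-r≡ ⟩
  a * tot q + (r₀ + l * a)     ≡⟨ solve 4 (λ a t l r₀ → a :* t :+ (r₀ :+ l :* a) := a :* (t :+ l) :+ r₀) refl a (tot q) l r₀ ⟩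
  a * (tot q + l) + r₀         ≡⟨ cong (λ z → a * z + r₀) tot-q+l≡ ⟩
  a * n + r₀                   ∎
  where open ≡-Reasoning

∑ⱽ-blocks : ∀ k a Q (h : Vec ℕ k → ℕ) → ∑ⱽ k (a * Q) h ≡ ∑ⱽ k a (λ r → ∑ⱽ k Q (λ q → h (scaleAdd a q r)))
∑ⱽ-blocks zero    a Q h = refl
∑ⱽ-blocks (suc k) a Q h = begin
  ∑[ i < a * Q ] ∑ⱽ k (a * Q) (λ w → h (i ∷ w))
    ≡⟨ ∑-cong (a * Q) (λ i _ → ∑ⱽ-blocks k a Q (λ w → h (i ∷ w))) ⟩
  ∑[ i < a * Q ] ∑ⱽ k a (λ r → ∑ⱽ k Q (λ q → h (i ∷ scaleAdd a q r)))
    ≡⟨ ∑-blocks a Q _ ⟩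
  ∑[ q₀ < Q ] ∑[ r₀ < a ] ∑ⱽ k a (λ r → ∑ⱽ k Q (λ q → h ((a * q₀ + r₀) ∷ scaleAdd a q r)))
    ≡⟨ ∑-comm Q a _ ⟩
  ∑[ r₀ < a ] ∑[ q₀ < Q ] ∑ⱽ k a (λ r → ∑ⱽ k Q (λ q → h ((a * q₀ + r₀) ∷ scaleAdd a q r)))
    ≡⟨ ∑-cong a (λ r₀ _ → sym (∑ⱽ-∑-comm k a Q (λ q₀ r → ∑ⱽ k Q (λ q → h ((a * q₀ + r₀) ∷ scaleAdd a q r))))) ⟩
  ∑[ r₀ < a ] ∑ⱽ k a (λ r → ∑[ q₀ < Q ] ∑ⱽ k Q (λ q → h ((a * q₀ + r₀) ∷ scaleAdd a q r)))
    ∎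
  where open ≡-Reasoning

tot<k*B : ∀ {k} B (w : Vec ℕ k) → 1 ≤ k → All (_< B) w → tot w < k * B
tot<k*B B (x ∷ w) _ (x<B ∷ w<B) = +-mono-<-≤ x<B (tot≤k*B w w<B)
  where
  tot≤k*B : ∀ {k} (w : Vec ℕ k) → All (_< B) w → tot w ≤ k * B
  tot≤k*B []      []          = z≤n
  tot≤k*B (x ∷ w) (x<B ∷ w<B) = +-mono-≤ (<⇒≤ x<B) (tot≤k*B w w<B)

when : ∀ {a} {P : Set a} → Dec P → ℕ → ℕ
when (yes _) x = x
when (no _)  x = 0

𝟙 : ∀ {a} {P : Set a} → Dec P → ℕ
𝟙 d = when d 1

when-yes : ∀ {a} {P : Set a} (d : Dec P) x → P → when d x ≡ x
when-yes (yes _) x _  = refl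
when-yes (no ¬p) x p  = ⊥-elim (¬p p)

when-no : ∀ {a} {P : Set a} (d : Dec P) x → ¬ P → when d x ≡ 0
when-no (yes p) x ¬p = ⊥-elim (¬p p)
when-no (no _)  x _  = refl

when-*ˡ : ∀ {a} {P : Set a} (d : Dec P) c x → c * when d x ≡ when d (c * x)
when-*ˡ (yes _) c x = refl
when-*ˡ (no _)  c x = *-zeroʳ c

when-when-disjoint : ∀ {a b} {P : Set a} {Q : Set b} (d : Dec P) (e : Dec Q) x → (P → Q → ⊥) → when d (when e x) ≡ 0
when-when-disjoint (yes p) (yes q) x disj = ⊥-elim (disj p q)
when-when-disjoint (yes _) (no _)  x _    = refl
when-when-disjoint (no _)  _       x _    = refl

when-⇔ : ∀ {a b} {P : Set a} {Q : Set b} (d : Dec P) (e : Dec Q) x → (P → Q) → (Q → P) → when d x ≡ when e x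
when-⇔ (yes _) (yes _) x _   _   = refl
when-⇔ (yes p) (no ¬q) x p⇒q _   = ⊥-elim (¬q (p⇒q p))
when-⇔ (no ¬p) (yes q) x _   q⇒p = ⊥-elim (¬p (q⇒p q))
when-⇔ (no _)  (no _)  x _   _   = refl

Σ-list-++ : ∀ {A : Set} (xs ys : List A) h → Σ-list (xs ++ ys) h ≡ Σ-list xs h + Σ-list ys h
Σ-list-++ []       ys h = refl
Σ-list-++ (x ∷ xs) ys h = trans (cong (h x +_) (Σ-list-++ xs ys h)) (sym (+-assoc (h x) _ _))

Σ-list-concatMap : ∀ {A B : Set} (f : A → List B) (xs : List A) h →
                   Σ-list (concatMap f xs) h ≡ Σ-list xs (λ a → Σ-list (f a) h)
Σ-list-concatMap f []       h = refl
Σ-list-concatMap f (x ∷ xs) h = trans (Σ-list-++ (f x) (concatMap f xs) h) (cong (Σ-list (f x) h +_) (Σ-list-concatMap f xs h))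

Σ-list-map : ∀ {A B : Set} (g : A → B) (xs : List A) h → Σ-list (L.map g xs) h ≡ Σ-list xs (h ∘ g)
Σ-list-map g []       h = refl
Σ-list-map g (x ∷ xs) h = cong (h (g x) +_) (Σ-list-map g xs h)

Σ-list-applyUpTo : ∀ n (f g : ℕ → ℕ) → Σ-list (applyUpTo f n) g ≡ ∑ n (g ∘ f)
Σ-list-applyUpTo zero    f g = refl
Σ-list-applyUpTo (suc n) f g = cong (g (f 0) +_) (Σ-list-applyUpTo n (f ∘ suc) g)

Σ-list-upTo : ∀ n (g : ℕ → ℕ) → Σ-list (upTo n) g ≡ ∑ n g
Σ-list-upTo n = Σ-list-applyUpTo n (λ i → i)

Σ-list-filter : ∀ {A : Set} {P : A → Set} (P? : ∀ a → Dec (P a)) (xs : List A) h →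
                Σ-list (L.filter P? xs) h ≡ Σ-list xs (λ a → when (P? a) (h a))
Σ-list-filter P? []       h = refl
Σ-list-filter P? (x ∷ xs) h with P? x
... | yes _ = cong (h x +_) (Σ-list-filter P? xs h)
... | no _  = Σ-list-filter P? xs h

Σ-list-allVecs : ∀ k B h → Σ-list (allVecs k B) h ≡ ∑ⱽ k B h
Σ-list-allVecs zero    B h = +-identityʳ (h [])
Σ-list-allVecs (suc k) B h = begin
  Σ-list (concatMap (λ i → L.map (i ∷_) (allVecs k B)) (upTo B)) h
    ≡⟨ Σ-list-concatMap _ (upTo B) h ⟩
  Σ-list (upTo B) (λ i → Σ-list (L.map (i ∷_) (allVecs k B)) h)
    ≡⟨ Σ-list-upTo B _ ⟩
  ∑[ i < B ] Σ-list (L.map (i ∷_) (allVecs k B)) h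
    ≡⟨ ∑-cong B (λ i _ → trans (Σ-list-map (i ∷_) (allVecs k B) h) (Σ-list-allVecs k B (λ w → h (i ∷ w)))) ⟩
  ∑ⱽ (suc k) B h
    ∎
  where open ≡-Reasoning

Σ-list-compositions : ∀ k n B h → n < B → Σ-list (compositions k n) h ≡ ∑ⱽ k B (λ v → when (tot v ≟ n) (h v))
Σ-list-compositions k n B h n<B = begin
  Σ-list (compositions k n) h                          ≡⟨ Σ-list-filter (λ v → tot v ≟ n) (allVecs k (suc n)) h ⟩
  Σ-list (allVecs k (suc n)) (λ v → when (tot v ≟ n) (h v)) ≡⟨ Σ-list-allVecs k (suc n) _ ⟩
  ∑ⱽ k (suc n) (λ v → when (tot v ≟ n) (h v))          ≡⟨ sym (∑ⱽ-vanishing-tail k n (suc n) B _ too-large ≤-refl n<B) ⟩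
  ∑ⱽ k B (λ v → when (tot v ≟ n) (h v))                ∎
  where
  open ≡-Reasoning
  too-large : ∀ w → n < tot w → when (tot w ≟ n) (h w) ≡ 0
  too-large w n<tot = when-no (tot w ≟ n) (h w) (λ tot≡n → <⇒≢ n<tot (sym tot≡n))

foldr-+-differences : ∀ {A : Set} (xs : List A) (a b : A → ℕ) →
  L.foldr ℤ._+_ (ℤ.+ 0) (L.map (λ j → ℤ.+ a j ℤ.- ℤ.+ b j) xs) ≡ ℤ.+ Σ-list xs a ℤ.- ℤ.+ Σ-list xs b
foldr-+-differences []       a b = refl
foldr-+-differences (x ∷ xs) a b = begin
  (ℤ.+ a x ℤ.- ℤ.+ b x) ℤ.+ L.foldr ℤ._+_ (ℤ.+ 0) (L.map (λ j → ℤ.+ a j ℤ.- ℤ.+ b j) xs)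
    ≡⟨ cong (λ z → (ℤ.+ a x ℤ.- ℤ.+ b x) ℤ.+ z) (foldr-+-differences xs a b) ⟩
  (ℤ.+ a x ℤ.- ℤ.+ b x) ℤ.+ (ℤ.+ Σa ℤ.- ℤ.+ Σb)
    ≡⟨ solveℤ 4 (λ x y u v → (x ⊝ y) ⊕ (u ⊝ v) ≐ (x ⊕ u) ⊝ (y ⊕ v)) refl (ℤ.+ a x) (ℤ.+ b x) (ℤ.+ Σa) (ℤ.+ Σb) ⟩
  (ℤ.+ a x ℤ.+ ℤ.+ Σa) ℤ.- (ℤ.+ b x ℤ.+ ℤ.+ Σb)
    ≡⟨ sym (cong₂ ℤ._-_ (ℤ.pos-+ (a x) Σa) (ℤ.pos-+ (b x) Σb)) ⟩
  ℤ.+ (a x + Σa) ℤ.- ℤ.+ (b x + Σb)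
    ∎
  where
  open ≡-Reasoning
  Σa = Σ-list xs a
  Σb = Σ-list xs b

Σℤ-range-differences : ∀ s (a b : ℕ → ℕ) →
  Σℤ-range 1 s (λ j → ℤ.+ a j ℤ.- ℤ.+ b j) ≡ ℤ.+ ∑[ e < s ] a (suc e) ℤ.- ℤ.+ ∑[ e < s ] b (suc e)
Σℤ-range-differences s a b = trans (foldr-+-differences (upTo s) (a ∘ suc) (b ∘ suc))
  (cong₂ (λ u v → ℤ.+ u ℤ.- ℤ.+ v) (Σ-list-upTo s (a ∘ suc)) (Σ-list-upTo s (b ∘ suc)))

∣a+[b-c]-d∣ : ∀ a b c d → d + c ≤ a + b → ℤ.∣ (ℤ.+ a ℤ.+ (ℤ.+ b ℤ.- ℤ.+ c)) ℤ.- ℤ.+ d ∣ ≡ (a + b) ∸ (d + c)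
∣a+[b-c]-d∣ a b c d d+c≤a+b = cong ℤ.∣_∣ (begin
  (ℤ.+ a ℤ.+ (ℤ.+ b ℤ.- ℤ.+ c)) ℤ.- ℤ.+ d
    ≡⟨ solveℤ 4 (λ a b c d → (a ⊕ (b ⊝ c)) ⊝ d ≐ (a ⊕ b) ⊝ (d ⊕ c)) refl (ℤ.+ a) (ℤ.+ b) (ℤ.+ c) (ℤ.+ d) ⟩
  (ℤ.+ a ℤ.+ ℤ.+ b) ℤ.- (ℤ.+ d ℤ.+ ℤ.+ c)
    ≡⟨ sym (cong₂ ℤ._-_ (ℤ.pos-+ a b) (ℤ.pos-+ d c)) ⟩
  ℤ.+ (a + b) ℤ.- ℤ.+ (d + c)
    ≡⟨ ℤ.[+m]-[+n]≡m⊖n (a + b) (d + c) ⟩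
  (a + b) ℤ.⊖ (d + c)
    ≡⟨ ℤ.⊖-≥ d+c≤a+b ⟩
  ℤ.+ ((a + b) ∸ (d + c))
    ∎)
  where open ≡-Reasoning

divN*≤ : ∀ m d → divN m d * d ≤ m
divN*≤ m zero    = z≤n
divN*≤ m (suc d) = m/n*n≤m m (suc d)

<[1+divN]* : ∀ m d → 1 ≤ d → m < suc (divN m d) * d
<[1+divN]* m (suc d) _ = begin-strict
  m                                ≡⟨ m≡m%n+[m/n]*n m (suc d) ⟩
  m % suc d + m / suc d * suc d    <⟨ +-monoˡ-< _ (m%n<n m (suc d)) ⟩
  suc d + m / suc d * suc d        ∎
  where open ≤-Reasoning

*≤⇒≤divN : ∀ x m d → 1 ≤ d → x * d ≤ m → x ≤ divN m d
*≤⇒≤divN x m (suc d) _ le = ≤-trans (≤-reflexive (sym (m*n/n≡m x (suc d)))) (/-monoˡ-≤ (suc d) le)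

divN-unique : ∀ m d q → 1 ≤ d → q * d ≤ m → m < suc q * d → divN m d ≡ q
divN-unique m (suc d) q 1≤d lo hi = ≤-antisym (≤-pred (m<n*o⇒m/o<n hi)) (*≤⇒≤divN q m (suc d) 1≤d lo)

divN-*-cancelʳ : ∀ q d → 1 ≤ d → divN (q * d) d ≡ q
divN-*-cancelʳ q (suc d) _ = m*n/n≡m q (suc d)

divN-suc : ∀ m d → 1 ≤ d → divN (suc m) d ≡ divN m d + 𝟙 (d ∣? suc m)
divN-suc m d 1≤d with d ∣? suc m
... | yes (divides c sm≡c*d) = begin
  divN (suc m) d     ≡⟨ cong (λ z → divN z d) sm≡c*d ⟩
  divN (c * d) d     ≡⟨ divN-*-cancelʳ c d 1≤d ⟩
  c                  ≡⟨ ≤-antisym c≤1+Q Q<c ⟩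
  suc Q              ≡⟨ +-comm 1 Q ⟩
  Q + 1              ∎
  where
  open ≡-Reasoning
  Q = divN m d
  Q<c : Q < c
  Q<c = *-cancelʳ-< d Q c (≤-trans (s≤s (divN*≤ m d)) (≤-reflexive sm≡c*d))
  c≤1+Q : c ≤ suc Q
  c≤1+Q = ≤-pred (*-cancelʳ-< d c (suc (suc Q))
    (≤-<-trans (≤-trans (≤-reflexive (sym sm≡c*d)) (<[1+divN]* m d 1≤d)) (+-monoˡ-< (suc Q * d) 1≤d)))
... | no d∤sm = trans (divN-unique (suc m) d Q 1≤d (≤-trans (divN*≤ m d) (n≤1+n m)) sm<[1+Q]*d) (sym (+-identityʳ Q))
  where
  Q = divN m d
  sm<[1+Q]*d : suc m < suc Q * d
  sm<[1+Q]*d = ≤∧≢⇒< (<[1+divN]* m d 1≤d) (λ eq → d∤sm (divides (suc Q) eq))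

∑-multiples : ∀ d → 1 ≤ d → ∀ m → ∑[ i < m ] 𝟙 (d ∣? suc i) ≡ divN m d
∑-multiples (suc d) _   zero    = refl
∑-multiples d       1≤d (suc m) = begin
  ∑[ i < suc m ] 𝟙 (d ∣? suc i)                ≡⟨ ∑-last m (λ i → 𝟙 (d ∣? suc i)) ⟩
  ∑[ i < m ] 𝟙 (d ∣? suc i) + 𝟙 (d ∣? suc m)   ≡⟨ cong (_+ 𝟙 (d ∣? suc m)) (∑-multiples d 1≤d m) ⟩
  divN m d + 𝟙 (d ∣? suc m)                    ≡⟨ sym (divN-suc m d 1≤d) ⟩
  divN (suc m) d                               ∎
  where open ≡-Reasoning

divN-superadditive : ∀ a b d → 1 ≤ d → divN a d + divN b d ≤ divN (a + b) d
divN-superadditive a b d 1≤d = *≤⇒≤divN _ _ d 1≤d (begin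
  (divN a d + divN b d) * d          ≡⟨ *-distribʳ-+ d (divN a d) (divN b d) ⟩
  divN a d * d + divN b d * d        ≤⟨ +-mono-≤ (divN*≤ a d) (divN*≤ b d) ⟩
  a + b                              ∎)
  where open ≤-Reasoning

∑-divN≤divN-tot : ∀ {k} d → 1 ≤ d → (w : Vec ℕ k) → V.sum (V.map (λ x → divN x d) w) ≤ divN (tot w) d
∑-divN≤divN-tot (suc d) _   []      = z≤n
∑-divN≤divN-tot d       1≤d (x ∷ w) =
  ≤-trans (+-monoʳ-≤ (divN x d) (∑-divN≤divN-tot d 1≤d w)) (divN-superadditive x (tot w) d 1≤d)

divN≤ : ∀ m d → divN m d ≤ m
divN≤ m zero    = z≤n
divN≤ m (suc d) = m/n≤m m (suc d)

divN-small : ∀ m d → m < d → divN m d ≡ 0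
divN-small m (suc d) m<d = m<n⇒m/n≡0 m<d

divN-divN : ∀ m a b → 1 ≤ a → 1 ≤ b → divN (divN m a) b ≡ divN m (a * b)
divN-divN m (suc a) (suc b) _ _ = m/n/o≡m/[n*o] m (suc a) (suc b)

divN-euclid : ∀ a q r → r < a → divN (a * q + r) a ≡ q
divN-euclid a q r r<a = divN-unique (a * q + r) a q (≤-trans z<s r<a)
  (≤-trans (≤-reflexive (*-comm q a)) (m≤m+n (a * q) r))
  (begin-strict
    a * q + r     <⟨ +-monoʳ-< (a * q) r<a ⟩
    a * q + a     ≡⟨ +-comm (a * q) a ⟩
    a + a * q     ≡⟨ cong (a +_) (*-comm a q) ⟩
    suc q * a     ∎)
  where open ≤-Reasoning

divN-linear : ∀ a d q r → 1 ≤ d → d ∣ a → divN (a * q + r) d ≡ q * divN a d + divN r d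
divN-linear a (suc d) q r _ d∣a = trans (+-distrib-/-∣ˡ r (∣-trans d∣a (m∣m*n q)))
  (cong (_+ r / suc d) (trans (cong (_/ suc d) (*-comm a q)) (*-/-assoc q d∣a)))

prime⇒2≤ : ∀ {p} → Prime p → 2 ≤ p
prime⇒2≤ {p} pp = nonTrivial⇒n>1 p {{prime⇒nonTrivial pp}}

^-monoʳ-∣ : ∀ p {a b} → a ≤ b → p ^ a ∣ p ^ b
^-monoʳ-∣ p {a} {b} a≤b = divides (p ^ (b ∸ a)) (trans (cong (p ^_) (sym (m∸n+n≡m a≤b))) (^-distribˡ-+-* p (b ∸ a) a))

IsValuation : ℕ → ℕ → ℕ → Set
IsValuation p m e = p ^ e ∣ m × ¬ (p ^ suc e ∣ m)

IsValuation-*p : ∀ p c e → 2 ≤ p → IsValuation p c e → IsValuation p (c * p) (suc e)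
IsValuation-*p p@(suc (suc _)) c e _ (p^e∣c , p^1+e∤c) =
    subst (p * p ^ e ∣_) (*-comm p c) (*-monoʳ-∣ p p^e∣c)
  , λ p^2+e∣cp → p^1+e∤c (*-cancelˡ-∣ p (subst (p * p ^ suc e ∣_) (*-comm c p) p^2+e∣cp))
IsValuation-*p (suc zero) c e (s≤s ()) _

ν[p,m]≤m : ∀ p m → ν p m ≤ m
ν[p,m]≤m p m = nuFuel≤fuel m m
  where
  nuFuel≤fuel : ∀ f m → nuFuel f p m ≤ f
  nuFuel≤fuel zero    m = z≤n
  nuFuel≤fuel (suc f) m with does (2 ≤? p) ∧ not (does (m ≟ 0)) ∧ does (p ∣? m)
  ... | true  = s≤s (nuFuel≤fuel f (divN m p))
  ... | false = z≤n

nuFuel-isValuation : ∀ f p m → 2 ≤ p → 1 ≤ m → m ≤ f → IsValuation p m (nuFuel f p m)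
nuFuel-isValuation zero    p m _   1≤m m≤0 = ⊥-elim (m<n⇒n≢0 1≤m (n≤0⇒n≡0 m≤0))
nuFuel-isValuation (suc f) p m 2≤p 1≤m m≤f
  rewrite dec-true (2 ≤? p) 2≤p | dec-false (m ≟ 0) (m<n⇒n≢0 1≤m) with p ∣? m
... | no p∤m = 1∣ m , λ p∣m → p∤m (subst (_∣ m) (*-identityʳ p) p∣m)
... | yes (divides c m≡c*p) =
  subst (λ z → IsValuation p z (suc (nuFuel f p (divN m p)))) (sym m≡c*p)
    (subst (λ z → IsValuation p (c * p) (suc (nuFuel f p z))) (sym m/p≡c)
      (IsValuation-*p p c (nuFuel f p c) 2≤p (nuFuel-isValuation f p c 2≤p 1≤c c≤f)))
  where
  m/p≡c : divN m p ≡ c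
  m/p≡c = trans (cong (λ z → divN z p) m≡c*p) (divN-*-cancelʳ c p (≤-trans (s≤s z≤n) 2≤p))
  1≤c : 1 ≤ c
  1≤c = n≢0⇒n>0 (λ { refl → m<n⇒n≢0 1≤m m≡c*p })
  c≤f : c ≤ f
  c≤f = ≤-pred (≤-trans (subst (c <_) (sym m≡c*p) (m<m*n c p 2≤p)) m≤f)
    where instance _ = >-nonZero 1≤c

ν-isValuation : ∀ p m → 2 ≤ p → 1 ≤ m → IsValuation p m (ν p m)
ν-isValuation p m 2≤p 1≤m = nuFuel-isValuation m p m 2≤p 1≤m ≤-refl

IsValuation-maximal : ∀ {p m e a} → IsValuation p m e → p ^ a ∣ m → a ≤ e
IsValuation-maximal {p} {m} {e} {a} (_ , p^1+e∤m) p^a∣m with a ≤? e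
... | yes a≤e = a≤e
... | no  a≰e = ⊥-elim (p^1+e∤m (∣-trans (^-monoʳ-∣ p (≰⇒> a≰e)) p^a∣m))

ν-unique : ∀ p m e → 2 ≤ p → 1 ≤ m → IsValuation p m e → ν p m ≡ e
ν-unique p m e 2≤p 1≤m v = ≤-antisym (IsValuation-maximal v (proj₁ νv)) (IsValuation-maximal νv (proj₁ v))
  where νv = ν-isValuation p m 2≤p 1≤m

p^a∣⇒a≤ν : ∀ p m a → 2 ≤ p → 1 ≤ m → p ^ a ∣ m → a ≤ ν p m
p^a∣⇒a≤ν p m a 2≤p 1≤m = IsValuation-maximal (ν-isValuation p m 2≤p 1≤m)

a≤ν⇒p^a∣ : ∀ p m a → 2 ≤ p → 1 ≤ m → a ≤ ν p m → p ^ a ∣ m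
a≤ν⇒p^a∣ p m a 2≤p 1≤m a≤ν = ∣-trans (^-monoʳ-∣ p a≤ν) (proj₁ (ν-isValuation p m 2≤p 1≤m))

ν-1 : ∀ p → 2 ≤ p → ν p 1 ≡ 0
ν-1 p 2≤p = ν-unique p 1 0 2≤p ≤-refl
  (1∣ 1 , λ p*1∣1 → <⇒≱ 2≤p (≤-reflexive (trans (sym (*-identityʳ p)) (∣1⇒≡1 p*1∣1))))

IsValuation-* : ∀ {p a b e f} → Prime p → IsValuation p a e → IsValuation p b f → IsValuation p (a * b) (e + f)
IsValuation-* {p} {a} {b} {e} {f} pp (divides ca a≡ca*p^e , p^1+e∤a) (divides cb b≡cb*p^f , p^1+f∤b) =
  divides (ca * cb) ab≡ , p^1+e+f∤ab
  where
  instance _ = prime⇒nonZero pp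
  ab≡ : a * b ≡ ca * cb * p ^ (e + f)
  ab≡ = begin
    a * b                          ≡⟨ cong₂ _*_ a≡ca*p^e b≡cb*p^f ⟩
    ca * p ^ e * (cb * p ^ f)      ≡⟨ solve 4 (λ x y u v → (x :* u) :* (y :* v) := (x :* y) :* (u :* v)) refl ca cb (p ^ e) (p ^ f) ⟩
    ca * cb * (p ^ e * p ^ f)      ≡⟨ cong (ca * cb *_) (sym (^-distribˡ-+-* p e f)) ⟩
    ca * cb * p ^ (e + f)          ∎
    where open ≡-Reasoning
  p∤ca : ¬ p ∣ ca
  p∤ca p∣ca = p^1+e∤a (subst (p * p ^ e ∣_) (sym a≡ca*p^e) (*-monoˡ-∣ (p ^ e) p∣ca))
  p∤cb : ¬ p ∣ cb
  p∤cb p∣cb = p^1+f∤b (subst (p * p ^ f ∣_) (sym b≡cb*p^f) (*-monoˡ-∣ (p ^ f) p∣cb))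
  p^1+e+f∤ab : ¬ (p ^ suc (e + f) ∣ a * b)
  p^1+e+f∤ab p^1+e+f∣ab
    with euclidsLemma ca cb pp (*-cancelʳ-∣ (p ^ (e + f)) {{m^n≢0 p (e + f)}} (subst (p * p ^ (e + f) ∣_) ab≡ p^1+e+f∣ab))
  ... | inj₁ p∣ca = p∤ca p∣ca
  ... | inj₂ p∣cb = p∤cb p∣cb

ν-* : ∀ p a b → Prime p → 1 ≤ a → 1 ≤ b → ν p (a * b) ≡ ν p a + ν p b
ν-* p a b pp 1≤a 1≤b = ν-unique p (a * b) _ 2≤p (*-mono-≤ 1≤a 1≤b)
  (IsValuation-* {e = ν p a} {f = ν p b} pp (ν-isValuation p a 2≤p 1≤a) (ν-isValuation p b 2≤p 1≤b))
  where 2≤p = prime⇒2≤ pp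

ν≡∑𝟙 : ∀ p m E → 2 ≤ p → 1 ≤ m → ν p m ≤ E → ν p m ≡ ∑[ e < E ] 𝟙 (p ^ suc e ∣? m)
ν≡∑𝟙 p m E 2≤p 1≤m ν≤E = sym (∑-indicator-prefix E (ν p m) _ ν≤E below above)
  where
  below : ∀ e → e < ν p m → 𝟙 (p ^ suc e ∣? m) ≡ 1
  below e e<ν = when-yes (p ^ suc e ∣? m) 1 (a≤ν⇒p^a∣ p m (suc e) 2≤p 1≤m e<ν)
  above : ∀ e → ν p m ≤ e → 𝟙 (p ^ suc e ∣? m) ≡ 0
  above e ν≤e = when-no (p ^ suc e ∣? m) 1 (λ p^1+e∣m → <⇒≱ (s≤s ν≤e) (p^a∣⇒a≤ν p m (suc e) 2≤p 1≤m p^1+e∣m))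

productOfPrimes∣ : ∀ fs → List.All Prime fs → ∀ a → 1 ≤ a →
                   (∀ q → Prime q → ν q (product fs) ≤ ν q a) → product fs ∣ a
productOfPrimes∣ []       _                  a _   _   = 1∣ a
productOfPrimes∣ (q ∷ fs) (prime-q List.∷ primes) a 1≤a ν-bounds =
  subst (q * product fs ∣_) (trans (*-comm q a′) (sym a≡a′*q)) (*-monoʳ-∣ q (productOfPrimes∣ fs primes a′ 1≤a′ ν-bounds′))
  where
  2≤q = prime⇒2≤ prime-q
  1≤q = ≤-trans (s≤s z≤n) 2≤q
  1≤P = productOfPrimes≥1 primes
  1≤ν[q,q*P] : 1 ≤ ν q (q * product fs)
  1≤ν[q,q*P] = p^a∣⇒a≤ν q _ 1 2≤q (*-mono-≤ 1≤q 1≤P) (subst (_∣ q * product fs) (sym (*-identityʳ q)) (m∣m*n _))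
  q∣a : q ∣ a
  q∣a = subst (_∣ a) (*-identityʳ q) (a≤ν⇒p^a∣ q a 1 2≤q 1≤a (≤-trans 1≤ν[q,q*P] (ν-bounds q prime-q)))
  a′ = quotient q∣a
  a≡a′*q : a ≡ a′ * q
  a≡a′*q = _∣_.equality q∣a
  1≤a′ : 1 ≤ a′
  1≤a′ = n≢0⇒n>0 (λ a′≡0 → m<n⇒n≢0 1≤a (trans a≡a′*q (cong (_* q) a′≡0)))
  ν-bounds′ : ∀ q′ → Prime q′ → ν q′ (product fs) ≤ ν q′ a′
  ν-bounds′ q′ prime-q′ = +-cancelˡ-≤ (ν q′ q) _ _ (begin
    ν q′ q + ν q′ (product fs)  ≡⟨ sym (ν-* q′ q (product fs) prime-q′ 1≤q 1≤P) ⟩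
    ν q′ (q * product fs)       ≤⟨ ν-bounds q′ prime-q′ ⟩
    ν q′ a                      ≡⟨ cong (ν q′) a≡a′*q ⟩
    ν q′ (a′ * q)               ≡⟨ ν-* q′ a′ q prime-q′ 1≤a′ 1≤q ⟩
    ν q′ a′ + ν q′ q            ≡⟨ +-comm (ν q′ a′) _ ⟩
    ν q′ q + ν q′ a′            ∎)
    where open ≤-Reasoning

ν≤⇒∣ : ∀ a b → 1 ≤ a → 1 ≤ b → (∀ q → Prime q → ν q b ≤ ν q a) → b ∣ a
ν≤⇒∣ a b 1≤a 1≤b ν-bounds = subst (_∣ a) (sym b≡∏) (productOfPrimes∣ factors factorsPrime a 1≤a
  (λ q prime-q → subst (λ z → ν q z ≤ ν q a) b≡∏ (ν-bounds q prime-q)))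
  where open PrimeFactorisation (factorise b {{>-nonZero 1≤b}}) renaming (isFactorisation to b≡∏)

ν-divN : ∀ p a b → Prime p → 1 ≤ a → b ∣ a → ν p (divN a b) + ν p b ≡ ν p a
ν-divN p a zero    pp 1≤a 0∣a = ⊥-elim (m<n⇒n≢0 1≤a (0∣⇒≡0 0∣a))
ν-divN p a (suc b) pp 1≤a b∣a =
  trans (sym (ν-* p (a / suc b) (suc b) pp (m≥n⇒m/n>0 (∣⇒≤ {{>-nonZero 1≤a}} b∣a)) z<s)) (cong (ν p) (m/n*n≡m b∣a))

-- Counting in sets of indices closed under gcd and multiples

module GcdClosed {P : ℕ → Set} (P? : ∀ i → Dec (P i))
         (gcd-closed : ∀ i j → 1 ≤ i → 1 ≤ j → P i → P j → P (gcd i j))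
         (multiple-closed : ∀ i j → 1 ≤ i → i ∣ j → 1 ≤ j → P i → P j) where

  IsLeast : ℕ → Set
  IsLeast d = 1 ≤ d × P d × (∀ i → 1 ≤ i → i < d → ¬ P i)

  count : ℕ → ℕ
  count n = ∑[ i < n ] 𝟙 (P? (suc i))

  least∣ : ∀ {d} → IsLeast d → ∀ i → 1 ≤ i → P i → d ∣ i
  least∣ {d} (1≤d , Pd , below) i 1≤i Pi = subst (_∣ i) g≡d (gcd[m,n]∣n d i)
    where
    g = gcd d i
    1≤g : 1 ≤ g
    1≤g = n≢0⇒n>0 (gcd[m,n]≢0 d i (inj₂ (m<n⇒n≢0 1≤i)))
    g≡d : g ≡ d
    g≡d = ≤-antisym (∣⇒≤ {{>-nonZero 1≤d}} (gcd[m,n]∣m d i))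
                    (≮⇒≥ (λ g<d → below g 1≤g g<d (gcd-closed d i 1≤d 1≤i Pd Pi)))

  count≡divN : ∀ {d} → IsLeast d → ∀ m → count m ≡ divN m d
  count≡divN {d} least@(1≤d , Pd , _) m =
    trans (∑-cong m (λ i _ → when-⇔ (P? (suc i)) (d ∣? suc i) 1
                              (least∣ least (suc i) z<s)
                              (λ d∣i → multiple-closed d (suc i) 1≤d d∣i z<s Pd)))
          (∑-multiples d 1≤d m)

  none-or-least : ∀ n → (∀ i → i < n → ¬ P (suc i)) ⊎ Σ ℕ IsLeast
  none-or-least zero = inj₁ (λ i ())
  none-or-least (suc n) with none-or-least n
  ... | inj₂ least = inj₂ least
  ... | inj₁ none with P? (suc n)
  ...   | yes Pn = inj₂ (suc n , z<s , Pn , λ { (suc i) _ (s≤s i<n) → none i i<n })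
  ...   | no ¬Pn = inj₁ λ i i<1+n → [ none i , (λ { refl → ¬Pn }) ]′ (m<1+n⇒m<n∨m≡n i<1+n)

  count-superadditive : ∀ a b → count a + count b ≤ count (a + b)
  count-superadditive a b with none-or-least (a + b)
  ... | inj₁ none = ≤-reflexive (trans (cong₂ _+_ (count-none a (m≤m+n a b)) (count-none b (m≤n+m b a)))
                                       (sym (count-none (a + b) ≤-refl)))
    where
    count-none : ∀ m → m ≤ a + b → count m ≡ 0
    count-none m m≤ = ∑-zero m (λ i i<m → when-no (P? (suc i)) 1 (none i (≤-trans i<m m≤)))
  ... | inj₂ (d , least) rewrite count≡divN least a | count≡divN least b | count≡divN least (a + b) =
    divN-superadditive a b d (proj₁ least)

  ∑-count≤count-tot : ∀ {k} (w : Vec ℕ k) → V.sum (V.map count w) ≤ count (tot w)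
  ∑-count≤count-tot []      = z≤n
  ∑-count≤count-tot (x ∷ w) = ≤-trans (+-monoʳ-≤ (count x) (∑-count≤count-tot w)) (count-superadditive x (tot w))

-- Valuations of C-orials

module StrongDivisibility (C : ℕ → ℤ) (sds : IsStrongDivSeq C) where

  c : ℕ → ℕ
  c i = ℤ.∣ C i ∣

  1≤c : ∀ i → 1 ≤ i → 1 ≤ c i
  1≤c i 1≤i = n≢0⇒n>0 (λ ci≡0 → proj₁ sds i 1≤i (ℤ.∣i∣≡0⇒i≡0 ci≡0))

  gcd-c : ∀ i j → 1 ≤ i → 1 ≤ j → gcd (c i) (c j) ≡ c (gcd i j)
  gcd-c i j 1≤i 1≤j = ℤ.+-injective (proj₂ sds i j 1≤i 1≤j)

  ∣⇒c∣c : ∀ i j → 1 ≤ i → i ∣ j → 1 ≤ j → c i ∣ c j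
  ∣⇒c∣c i j 1≤i i∣j 1≤j = subst (_∣ c j) (trans (gcd-c i j 1≤i 1≤j) (cong c gcd[i,j]≡i)) (gcd[m,n]∣n (c i) (c j))
    where
    gcd[i,j]≡i : gcd i j ≡ i
    gcd[i,j]≡i = ∣-antisym (gcd[m,n]∣m i j) (gcd-greatest ∣-refl i∣j)

  module Divisors (d : ℕ) = GcdClosed (λ i → d ∣? c i)
    (λ i j 1≤i 1≤j d∣ci d∣cj → subst (d ∣_) (gcd-c i j 1≤i 1≤j) (gcd-greatest d∣ci d∣cj))
    (λ i j 1≤i i∣j 1≤j d∣ci → ∣-trans d∣ci (∣⇒c∣c i j 1≤i i∣j 1≤j))

  open Divisors using (count)

  orial : ℕ → ℕ
  orial n = ℤ.∣ orialC C n ∣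

  orial-suc : ∀ n → orial (suc n) ≡ c (suc n) * orial n
  orial-suc n = ℤ.abs-* (C (suc n)) (orialC C n)

  1≤orial : ∀ n → 1 ≤ orial n
  1≤orial zero    = ≤-refl
  1≤orial (suc n) = subst (1 ≤_) (sym (orial-suc n)) (*-mono-≤ (1≤c (suc n) z<s) (1≤orial n))

  ν-orial : ∀ q → Prime q → ∀ n → ν q (orial n) ≡ ∑[ i < n ] ν q (c (suc i))
  ν-orial q prime-q zero    = ν-1 q (prime⇒2≤ prime-q)
  ν-orial q prime-q (suc n) = begin
    ν q (orial (suc n))                              ≡⟨ cong (ν q) (orial-suc n) ⟩
    ν q (c (suc n) * orial n)                        ≡⟨ ν-* q _ _ prime-q (1≤c (suc n) z<s) (1≤orial n) ⟩
    ν q (c (suc n)) + ν q (orial n)                  ≡⟨ +-comm (ν q (c (suc n))) _ ⟩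
    ν q (orial n) + ν q (c (suc n))                  ≡⟨ cong (_+ ν q (c (suc n))) (ν-orial q prime-q n) ⟩
    ∑[ i < n ] ν q (c (suc i)) + ν q (c (suc n))     ≡⟨ sym (∑-last n (λ i → ν q (c (suc i)))) ⟩
    ∑[ i < suc n ] ν q (c (suc i))                   ∎
    where open ≡-Reasoning

  ν-orial≡∑count : ∀ q → Prime q → ∀ n E → (∀ i → i < n → ν q (c (suc i)) ≤ E) →
                   ν q (orial n) ≡ ∑[ e < E ] count (q ^ suc e) n
  ν-orial≡∑count q prime-q n E ν≤E = begin
    ν q (orial n)
      ≡⟨ ν-orial q prime-q n ⟩
    ∑[ i < n ] ν q (c (suc i))
      ≡⟨ ∑-cong n (λ i i<n → ν≡∑𝟙 q (c (suc i)) E (prime⇒2≤ prime-q) (1≤c (suc i) z<s) (ν≤E i i<n)) ⟩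
    ∑[ i < n ] ∑[ e < E ] 𝟙 (q ^ suc e ∣? c (suc i))
      ≡⟨ ∑-comm n E (λ i e → 𝟙 (q ^ suc e ∣? c (suc i))) ⟩
    ∑[ e < E ] count (q ^ suc e) n
      ∎
    where open ≡-Reasoning

  levelBound : ℕ → ℕ
  levelBound n = ∑[ i < n ] c (suc i)

  ν-c≤levelBound : ∀ q {m n} → m ≤ n → ∀ i → i < m → ν q (c (suc i)) ≤ levelBound n
  ν-c≤levelBound q m≤n i i<m = ≤-trans (ν[p,m]≤m q _) (∑-≤-term _ (λ i → c (suc i)) i (≤-trans i<m m≤n))

  orials : ∀ {k} → Vec ℕ k → ℕ
  orials w = ℤ.∣ V.foldr (λ _ → ℤ) (λ a acc → orialC C a ℤ.* acc) (ℤ.+ 1) w ∣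

  orials-∷ : ∀ {k} a (w : Vec ℕ k) → orials (a ∷ w) ≡ orial a * orials w
  orials-∷ a w = ℤ.abs-* (orialC C a) _

  1≤orials : ∀ {k} (w : Vec ℕ k) → 1 ≤ orials w
  1≤orials []      = ≤-refl
  1≤orials (a ∷ w) = subst (1 ≤_) (sym (orials-∷ a w)) (*-mono-≤ (1≤orial a) (1≤orials w))

  ν-orials : ∀ q → Prime q → ∀ {k} (w : Vec ℕ k) → ν q (orials w) ≡ V.sum (V.map (ν q ∘ orial) w)
  ν-orials q prime-q []      = ν-1 q (prime⇒2≤ prime-q)
  ν-orials q prime-q (a ∷ w) = trans (cong (ν q) (orials-∷ a w))
    (trans (ν-* q _ _ prime-q (1≤orial a) (1≤orials w)) (cong (ν q (orial a) +_) (ν-orials q prime-q w)))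

  ∑ν-orial≡∑∑count : ∀ q → Prime q → ∀ {k} N (w : Vec ℕ k) → tot w ≤ N →
                     V.sum (V.map (ν q ∘ orial) w) ≡ ∑[ e < levelBound N ] V.sum (V.map (count (q ^ suc e)) w)
  ∑ν-orial≡∑∑count q prime-q N []      _ = sym (∑-0 (levelBound N))
  ∑ν-orial≡∑∑count q prime-q N (x ∷ w) x+tot≤N =
    trans (cong₂ _+_ (ν-orial≡∑count q prime-q x (levelBound N) (ν-c≤levelBound q (≤-trans (m≤m+n x (tot w)) x+tot≤N)))
                     (∑ν-orial≡∑∑count q prime-q N w (≤-trans (m≤n+m (tot w) x) x+tot≤N)))
          (sym (∑-+ (levelBound N) (λ e → count (q ^ suc e) x) _))

  ν-orials≤ν-orial-tot : ∀ q → Prime q → ∀ {k} (w : Vec ℕ k) → ν q (orials w) ≤ ν q (orial (tot w))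
  ν-orials≤ν-orial-tot q prime-q w = begin
    ν q (orials w)
      ≡⟨ ν-orials q prime-q w ⟩
    V.sum (V.map (ν q ∘ orial) w)
      ≡⟨ ∑ν-orial≡∑∑count q prime-q (tot w) w ≤-refl ⟩
    ∑[ e < E ] V.sum (V.map (count (q ^ suc e)) w)
      ≤⟨ ∑-mono-≤ E (λ e _ → Divisors.∑-count≤count-tot (q ^ suc e) w) ⟩
    ∑[ e < E ] count (q ^ suc e) (tot w)
      ≡⟨ sym (ν-orial≡∑count q prime-q (tot w) E (ν-c≤levelBound q ≤-refl)) ⟩
    ν q (orial (tot w))
      ∎
    where
    open ≤-Reasoning
    E = levelBound (tot w)

  orials∣orial-tot : ∀ {k} (w : Vec ℕ k) → orials w ∣ orial (tot w)
  orials∣orial-tot w = ν≤⇒∣ _ _ (1≤orial (tot w)) (1≤orials w) (λ q prime-q → ν-orials≤ν-orial-tot q prime-q w)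

  ν-multinomialC : ∀ p → Prime p → ∀ {k} (w : Vec ℕ k) →
                   ν p (multinomialC C w) + V.sum (V.map (ν p ∘ orial) w) ≡ ν p (orial (tot w))
  ν-multinomialC p prime-p w = trans (cong (ν p (multinomialC C w) +_) (sym (ν-orials p prime-p w)))
                                     (ν-divN p _ _ prime-p (1≤orial (tot w)) (orials∣orial-tot w))

-- Ordinary factorials, as the C-orials of C i = i

id-isStrongDivSeq : IsStrongDivSeq (λ i → ℤ.+ i)
id-isStrongDivSeq = (λ n 1≤n n≡0 → m<n⇒n≢0 1≤n (ℤ.+-injective n≡0)) , (λ _ _ _ _ → refl)

module Identity = StrongDivisibility (λ i → ℤ.+ i) id-isStrongDivSeq

orial≡! : ∀ n → Identity.orial n ≡ n !
orial≡! zero    = refl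
orial≡! (suc n) = trans (Identity.orial-suc n) (cong (suc n *_) (orial≡! n))

orials≡∏! : ∀ {k} (w : Vec ℕ k) → Identity.orials w ≡ V.foldr (λ _ → ℕ) (λ a acc → a ! * acc) 1 w
orials≡∏! []      = refl
orials≡∏! (a ∷ w) = trans (Identity.orials-∷ a w) (cong₂ _*_ (orial≡! a) (orials≡∏! w))

ν-multinomial : ∀ p → Prime p → ∀ {k} (w : Vec ℕ k) →
                ν p (multinomial w) + V.sum (V.map (λ x → ν p (x !)) w) ≡ ν p (tot w !)
ν-multinomial p prime-p w = begin
  ν p (multinomial w) + V.sum (V.map (λ x → ν p (x !)) w)
    ≡⟨ cong₂ (λ a b → ν p a + b) (cong₂ divN (sym (orial≡! (tot w))) (sym (orials≡∏! w))) (sym (∑ν-orial≡∑ν! w)) ⟩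
  ν p (multinomialC (λ i → ℤ.+ i) w) + V.sum (V.map (ν p ∘ Identity.orial) w)
    ≡⟨ Identity.ν-multinomialC p prime-p w ⟩
  ν p (Identity.orial (tot w))
    ≡⟨ cong (ν p) (orial≡! (tot w)) ⟩
  ν p (tot w !)
    ∎
  where
  open ≡-Reasoning
  ∑ν-orial≡∑ν! : ∀ {j} (v : Vec ℕ j) → V.sum (V.map (ν p ∘ Identity.orial) v) ≡ V.sum (V.map (λ x → ν p (x !)) v)
  ∑ν-orial≡∑ν! []      = refl
  ∑ν-orial≡∑ν! (x ∷ v) = cong₂ _+_ (cong (ν p) (orial≡! x)) (∑ν-orial≡∑ν! v)

legendre : ∀ p → Prime p → ∀ n E → n ≤ E → ν p (n !) ≡ ∑[ e < E ] divN n (p ^ suc e)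
legendre p prime-p n E n≤E = begin
  ν p (n !)
    ≡⟨ cong (ν p) (sym (orial≡! n)) ⟩
  ν p (Identity.orial n)
    ≡⟨ Identity.ν-orial≡∑count p prime-p n E (λ i i<n → ≤-trans (ν[p,m]≤m p (suc i)) (≤-trans i<n n≤E)) ⟩
  ∑[ e < E ] Identity.Divisors.count (p ^ suc e) n
    ≡⟨ ∑-cong E (λ e _ → ∑-multiples (p ^ suc e) (m^n>0 p (suc e)) n) ⟩
  ∑[ e < E ] divN n (p ^ suc e)
    ∎
  where
  open ≡-Reasoning
  instance _ = prime⇒nonZero prime-p

ν-fallingFactorial : ∀ p → Prime p → ∀ n l → l ≤ n → ν p (divN (n !) ((n ∸ l) !)) + ν p ((n ∸ l) !) ≡ ν p (n !)
ν-fallingFactorial p prime-p n l l≤n =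
  ν-divN p (n !) ((n ∸ l) !) prime-p (1≤n! n) (∣-trans (n∣m*n (l !)) (k![n∸k]!∣n! l≤n))

ν-!-split : ∀ p → Prime p → ∀ {k} (q : Vec ℕ k) l {n} → tot q + l ≡ n →
            ν p (n !) ≡ ν p (divN (n !) ((n ∸ l) !)) + (ν p (multinomial q) + V.sum (V.map (λ x → ν p (x !)) q))
ν-!-split p prime-p q l {n} tot-q+l≡n = begin
  ν p (n !)
    ≡⟨ sym (ν-fallingFactorial p prime-p n l (subst (l ≤_) tot-q+l≡n (m≤n+m l (tot q)))) ⟩
  ν p (divN (n !) ((n ∸ l) !)) + ν p ((n ∸ l) !)
    ≡⟨ cong (λ z → ν p (divN (n !) ((n ∸ l) !)) + ν p (z !)) (trans (cong (_∸ l) (sym tot-q+l≡n)) (m+n∸n≡m (tot q) l)) ⟩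
  ν p (divN (n !) ((n ∸ l) !)) + ν p (tot q !)
    ≡⟨ cong (ν p (divN (n !) ((n ∸ l) !)) +_) (sym (ν-multinomial p prime-p q)) ⟩
  ν p (divN (n !) ((n ∸ l) !)) + (ν p (multinomial q) + V.sum (V.map (λ x → ν p (x !)) q))
    ∎
  where open ≡-Reasoning

module Acceptable (C : ℕ → ℤ) (sds : IsStrongDivSeq C) (p : ℕ) (prime-p : Prime p)
                  (α : ℕ → ℕ) (s : ℕ) (acc : IsAcceptable C p α s) where

  open StrongDivisibility C sds

  rank : ∀ e → 1 ≤ e → IsRankOfApparition C (p ^ e) (α e)
  rank = proj₁ acc

  1≤s : 1 ≤ s
  1≤s = proj₁ (proj₂ acc)

  α-pred∣α : ∀ e → 2 ≤ e → e ≤ s → α (e ∸ 1) ∣ α e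
  α-pred∣α = proj₁ (proj₂ (proj₂ acc))

  α≡p*α-pred : ∀ e → s < e → α e ≡ p * α (e ∸ 1)
  α≡p*α-pred = proj₂ (proj₂ (proj₂ acc))

  A : ℕ
  A = α s

  1≤α : ∀ e → 1 ≤ e → 1 ≤ α e
  1≤α e 1≤e = proj₁ (rank e 1≤e)

  1≤A : 1 ≤ A
  1≤A = 1≤α s 1≤s

  α∣α : ∀ {i} j → 1 ≤ i → i ≤ j → j ≤ s → α i ∣ α j
  α∣α     zero    1≤i i≤0 _ = ⊥-elim (<⇒≱ 1≤i i≤0)
  α∣α {i} (suc j) 1≤i i≤1+j 1+j≤s with m≤n⇒m<n∨m≡n i≤1+j
  ... | inj₂ refl      = ∣-refl
  ... | inj₁ (s≤s i≤j) = ∣-trans (α∣α j 1≤i i≤j (≤-trans (n≤1+n j) 1+j≤s))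
                                 (α-pred∣α (suc j) (s≤s (≤-trans 1≤i i≤j)) 1+j≤s)

  α∣A : ∀ e → e < s → α (suc e) ∣ A
  α∣A e e<s = α∣α s z<s e<s ≤-refl

  α[1+s+t]≡p^[1+t]*A : ∀ t → α (suc (s + t)) ≡ p ^ suc t * A
  α[1+s+t]≡p^[1+t]*A zero = begin
    α (suc (s + 0))     ≡⟨ α≡p*α-pred (suc (s + 0)) (s≤s (m≤m+n s 0)) ⟩
    p * α (s + 0)       ≡⟨ cong (λ z → p * α z) (+-identityʳ s) ⟩
    p * A               ≡⟨ cong (_* A) (sym (*-identityʳ p)) ⟩
    p ^ 1 * A           ∎
    where open ≡-Reasoning
  α[1+s+t]≡p^[1+t]*A (suc t) = begin
    α (suc (s + suc t))     ≡⟨ α≡p*α-pred (suc (s + suc t)) (s≤s (m≤m+n s (suc t))) ⟩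
    p * α (s + suc t)       ≡⟨ cong (λ z → p * α z) (+-suc s t) ⟩
    p * α (suc (s + t))     ≡⟨ cong (p *_) (α[1+s+t]≡p^[1+t]*A t) ⟩
    p * (p ^ suc t * A)     ≡⟨ sym (*-assoc p (p ^ suc t) A) ⟩
    p ^ suc (suc t) * A     ∎
    where open ≡-Reasoning

  -- IsRankOfApparition C d is definitionally Divisors.IsLeast d.
  count≡divN-α : ∀ e m → Divisors.count (p ^ suc e) m ≡ divN m (α (suc e))
  count≡divN-α e = Divisors.count≡divN (p ^ suc e) (rank (suc e) z<s)

  R : ℕ → ℕ
  R y = ∑[ e < s ] divN y (α (suc e))

  ν-orial≡R+ν! : ∀ m → ν p (orial m) ≡ R m + ν p (divN m A !)
  ν-orial≡R+ν! m = begin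
    ν p (orial m)
      ≡⟨ ν-orial≡∑count p prime-p m (s + E) (λ i i<m → ≤-trans (ν-c≤levelBound p ≤-refl i i<m)
                                                                (≤-trans (m≤m+n (levelBound m) m) (m≤n+m _ s))) ⟩
    ∑[ e < s + E ] Divisors.count (p ^ suc e) m
      ≡⟨ trans (∑-cong (s + E) (λ e _ → count≡divN-α e m)) (∑-split s E _) ⟩
    R m + ∑[ t < E ] divN m (α (suc (s + t)))
      ≡⟨ cong (R m +_) (∑-cong E (λ t _ → trans (cong (divN m) (trans (α[1+s+t]≡p^[1+t]*A t) (*-comm (p ^ suc t) A)))
                                                 (sym (divN-divN m A (p ^ suc t) 1≤A (m^n>0 p (suc t)))))) ⟩
    R m + ∑[ t < E ] divN (divN m A) (p ^ suc t)
      ≡⟨ cong (R m +_) (sym (legendre p prime-p (divN m A) E (≤-trans (divN≤ m A) (m≤n+m m (levelBound m))))) ⟩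
    R m + ν p (divN m A !)
      ∎
    where
    open ≡-Reasoning
    instance _ = prime⇒nonZero prime-p
    E = levelBound m + m

  R-linear : ∀ x y → R (A * x + y) ≡ x * R A + R y
  R-linear x y = begin
    ∑[ e < s ] divN (A * x + y) (α (suc e))
      ≡⟨ ∑-cong s (λ e e<s → divN-linear A (α (suc e)) x y (1≤α (suc e) z<s) (α∣A e e<s)) ⟩
    ∑[ e < s ] (x * divN A (α (suc e)) + divN y (α (suc e)))
      ≡⟨ ∑-+ s _ _ ⟩
    ∑[ e < s ] (x * divN A (α (suc e))) + R y
      ≡⟨ cong (_+ R y) (∑-*ˡ s x _) ⟩
    x * R A + R y
      ∎
    where open ≡-Reasoning

  ν-orial-euclid : ∀ x y → y < A → ν p (orial (A * x + y)) ≡ x * R A + R y + ν p (x !)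
  ν-orial-euclid x y y<A = begin
    ν p (orial (A * x + y))                      ≡⟨ ν-orial≡R+ν! (A * x + y) ⟩
    R (A * x + y) + ν p (divN (A * x + y) A !)   ≡⟨ cong₂ (λ u v → u + ν p (v !)) (R-linear x y) (divN-euclid A x y y<A) ⟩
    x * R A + R y + ν p (x !)                    ∎
    where open ≡-Reasoning

  ∑ν-orial-scaleAdd : ∀ {k} (q r : Vec ℕ k) → All (_< A) r →
    V.sum (V.map (ν p ∘ orial) (scaleAdd A q r)) ≡ tot q * R A + V.sum (V.map R r) + V.sum (V.map (λ x → ν p (x !)) q)
  ∑ν-orial-scaleAdd []      []      []          = refl
  ∑ν-orial-scaleAdd (x ∷ q) (y ∷ r) (y<A ∷ r<A) = trans (cong₂ _+_ (ν-orial-euclid x y y<A) (∑ν-orial-scaleAdd q r r<A))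
    (solve 7 (λ x RA Ry νx tq ∑R ∑ν → (x :* RA :+ Ry :+ νx) :+ (tq :* RA :+ ∑R :+ ∑ν)
                                    := (x :+ tq) :* RA :+ (Ry :+ ∑R) :+ (νx :+ ∑ν)) refl
       x (R A) (R y) (ν p (x !)) (tot q) (V.sum (V.map R r)) (V.sum (V.map (λ x → ν p (x !)) q)))

  s⁻ : ℕ
  s⁻ = s ∸ 1

  R⁻ : ℕ → ℕ
  R⁻ y = ∑[ e < s⁻ ] divN y (α (suc e))

  R≡R⁻+divN : ∀ y → R y ≡ R⁻ y + divN y A
  R≡R⁻+divN y = trans (cong (λ z → ∑[ e < z ] divN y (α (suc e))) s≡1+s⁻)
                      (trans (∑-last s⁻ _) (cong (λ z → R⁻ y + divN y (α z)) (sym s≡1+s⁻)))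
    where
    s≡1+s⁻ : s ≡ suc s⁻
    s≡1+s⁻ = sym (m+[n∸m]≡n 1≤s)

  ∑R⁻≤R⁻-tot : ∀ {k} (r : Vec ℕ k) → V.sum (V.map R⁻ r) ≤ R⁻ (tot r)
  ∑R⁻≤R⁻-tot r = begin
    V.sum (V.map R⁻ r)
      ≡⟨ sym (∑-sum-comm s⁻ (λ x e → divN x (α (suc e))) r) ⟩
    ∑[ e < s⁻ ] V.sum (V.map (λ x → divN x (α (suc e))) r)
      ≤⟨ ∑-mono-≤ s⁻ (λ e _ → ∑-divN≤divN-tot (α (suc e)) (1≤α (suc e) z<s) r) ⟩
    R⁻ (tot r)
      ∎
    where open ≤-Reasoning

  ∑R≡∑R⁻ : ∀ {k} (r : Vec ℕ k) → All (_< A) r → V.sum (V.map R r) ≡ V.sum (V.map R⁻ r)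
  ∑R≡∑R⁻ []      []          = refl
  ∑R≡∑R⁻ (y ∷ r) (y<A ∷ r<A) =
    cong₂ _+_ (trans (R≡R⁻+divN y) (trans (cong (R⁻ y +_) (divN-small y A y<A)) (+-identityʳ _))) (∑R≡∑R⁻ r r<A)

  -- The top level j = s sees the l carries of r₁ + ⋯ + r_k = r₀ + l·A, which no single rᵢ < A reaches.
  l+∑R≤R-tot : ∀ {k} l r₀ (r : Vec ℕ k) → r₀ < A → All (_< A) r → tot r ≡ r₀ + l * A →
               l + V.sum (V.map R r) ≤ l * R A + R r₀
  l+∑R≤R-tot l r₀ r r₀<A r<A tot≡ = begin
    l + V.sum (V.map R r)             ≡⟨ cong (l +_) (∑R≡∑R⁻ r r<A) ⟩
    l + V.sum (V.map R⁻ r)            ≤⟨ +-monoʳ-≤ l (∑R⁻≤R⁻-tot r) ⟩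
    l + R⁻ (tot r)                    ≡⟨ cong (λ z → l + R⁻ z) tot≡' ⟩
    l + R⁻ (A * l + r₀)               ≡⟨ +-comm l _ ⟩
    R⁻ (A * l + r₀) + l               ≡⟨ cong (R⁻ (A * l + r₀) +_) (sym (divN-euclid A l r₀ r₀<A)) ⟩
    R⁻ (A * l + r₀) + divN (A * l + r₀) A ≡⟨ sym (R≡R⁻+divN (A * l + r₀)) ⟩
    R (A * l + r₀)                    ≡⟨ R-linear l r₀ ⟩
    l * R A + R r₀                    ∎
    where
    open ≤-Reasoning
    tot≡' : tot r ≡ A * l + r₀
    tot≡' = trans tot≡ (trans (+-comm r₀ _) (cong (_+ r₀) (*-comm l A)))

  ∣f-l∣≡ : ∀ {k} l r₀ (r : Vec ℕ k) → l + V.sum (V.map R r) ≤ l * R A + R r₀ →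
           ℤ.∣ fpkC α s k l r₀ r ℤ.- ℤ.+ l ∣ ≡ (l * R A + R r₀) ∸ (l + V.sum (V.map R r))
  ∣f-l∣≡ {k} l r₀ r le =
    trans (cong (λ z → ℤ.∣ z ℤ.- ℤ.+ l ∣) f≡) (∣a+[b-c]-d∣ (l * R A) (R r₀) (V.sum (V.map R r)) l le)
    where
    f≡ : fpkC α s k l r₀ r ≡ ℤ.+ (l * R A) ℤ.+ (ℤ.+ R r₀ ℤ.- ℤ.+ V.sum (V.map R r))
    f≡ = cong₂ (λ u v → ℤ.+ (l * u) ℤ.+ v) (Σ-list-upTo s _)
               (trans (Σℤ-range-differences s (divN r₀ ∘ α) (λ j → V.sum (V.map (λ x → divN x (α j)) r)))
                      (cong (λ z → ℤ.+ R r₀ ℤ.- ℤ.+ z) (∑-sum-comm s (λ x e → divN x (α (suc e))) r)))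

  ν-multinomialC-scaleAdd : ∀ {k} n′ r₀ l (q r : Vec ℕ k) → r₀ < A → All (_< A) r →
    tot r ≡ r₀ + l * A → tot q + l ≡ n′ →
    ν p (multinomialC C (scaleAdd A q r)) ≡
      ℤ.∣ fpkC α s k l r₀ r ℤ.- ℤ.+ l ∣ + (ν p (divN (n′ !) ((n′ ∸ l) !)) + l) + ν p (multinomial q)
  ν-multinomialC-scaleAdd {k} n′ r₀ l q r r₀<A r<A tot-r≡ tot-q+l≡ =
    trans (+-cancelʳ-≡ rest νC _ νC+rest≡) (cong (λ z → z + (D + l) + νq) (sym (∣f-l∣≡ l r₀ r l+∑R≤)))
    where
    m = scaleAdd A q r
    νC = ν p (multinomialC C m)
    νq = ν p (multinomial q)
    D = ν p (divN (n′ !) ((n′ ∸ l) !))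
    ∑R = V.sum (V.map R r)
    ∑ν! = V.sum (V.map (λ x → ν p (x !)) q)
    rest = tot q * R A + ∑R + ∑ν!
    l+∑R≤ = l+∑R≤R-tot l r₀ r r₀<A r<A tot-r≡
    G = (l * R A + R r₀) ∸ (l + ∑R)

    νC+rest≡ : νC + rest ≡ G + (D + l) + νq + rest
    νC+rest≡ = begin
      νC + (tot q * R A + ∑R + ∑ν!)
        ≡⟨ cong (νC +_) (sym (∑ν-orial-scaleAdd q r r<A)) ⟩
      νC + V.sum (V.map (ν p ∘ orial) m)
        ≡⟨ ν-multinomialC p prime-p m ⟩
      ν p (orial (tot m))
        ≡⟨ cong (ν p ∘ orial) (tot-scaleAdd-carry A q r tot-r≡ tot-q+l≡) ⟩
      ν p (orial (A * n′ + r₀))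
        ≡⟨ ν-orial-euclid n′ r₀ r₀<A ⟩
      n′ * R A + R r₀ + ν p (n′ !)
        ≡⟨ cong₂ (λ u v → u * R A + R r₀ + v) (sym tot-q+l≡) (ν-!-split p prime-p q l tot-q+l≡) ⟩
      (tot q + l) * R A + R r₀ + (D + (νq + ∑ν!))
        ≡⟨ solve 7 (λ t l RA Rr₀ D νq ∑ν → (t :+ l) :* RA :+ Rr₀ :+ (D :+ (νq :+ ∑ν))
                                          := t :* RA :+ (l :* RA :+ Rr₀) :+ (D :+ νq :+ ∑ν))
                   refl (tot q) l (R A) (R r₀) D νq ∑ν! ⟩
      tot q * R A + (l * R A + R r₀) + (D + νq + ∑ν!)
        ≡⟨ cong (λ z → tot q * R A + z + (D + νq + ∑ν!)) (sym (m+[n∸m]≡n l+∑R≤)) ⟩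
      tot q * R A + (l + ∑R + G) + (D + νq + ∑ν!)
        ≡⟨ solve 8 (λ t RA l ∑R G D νq ∑ν → t :* RA :+ (l :+ ∑R :+ G) :+ (D :+ νq :+ ∑ν)
                                           := G :+ (D :+ l) :+ νq :+ (t :* RA :+ ∑R :+ ∑ν))
                   refl (tot q) (R A) l ∑R G D νq ∑ν! ⟩
      G + (D + l) + νq + (tot q * R A + ∑R + ∑ν!)
        ∎
      where open ≡-Reasoning

Tλ≡∑ⱽ : ∀ p k l n′ x → Tλ p k l n′ x ≡
  x ^ (ν p (divN (n′ !) ((n′ ∸ l) !)) + l) * ∑ⱽ k (suc n′) (λ q → when (tot q + l ≟ n′) (x ^ ν p (multinomial q)))
Tλ≡∑ⱽ p k l n′ x with n′ <? l
... | yes n′<l = sym (trans (cong (c *_) (∑ⱽ-zero k (suc n′) (λ q _ → when-no (tot q + l ≟ n′) _ (λ tot+l≡n′ →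
                   <⇒≱ n′<l (subst (l ≤_) tot+l≡n′ (m≤n+m l (tot q)))))))
                 (*-zeroʳ c))
  where c = x ^ (ν p (divN (n′ !) ((n′ ∸ l) !)) + l)
... | no n′≮l = cong (x ^ (ν p (divN (n′ !) ((n′ ∸ l) !)) + l) *_) (begin
  T p k (n′ ∸ l) x
    ≡⟨ Σ-list-compositions k (n′ ∸ l) (suc n′) _ (s≤s (m∸n≤m n′ l)) ⟩
  ∑ⱽ k (suc n′) (λ q → when (tot q ≟ n′ ∸ l) (x ^ ν p (multinomial q)))
    ≡⟨ ∑ⱽ-cong k (suc n′) (λ q _ → when-⇔ (tot q ≟ n′ ∸ l) (tot q + l ≟ n′) _
         (λ tot≡ → trans (cong (_+ l) tot≡) (m∸n+n≡m (≮⇒≥ n′≮l)))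
         (λ tot+l≡ → trans (sym (m+n∸n≡m (tot q) l)) (cong (_∸ l) tot+l≡))) ⟩
  ∑ⱽ k (suc n′) (λ q → when (tot q + l ≟ n′) (x ^ ν p (multinomial q)))
    ∎)
  where open ≡-Reasoning

-- Splitting each composition of A n′ + r₀ into A-adic quotients and remainders

module Decomposition (C : ℕ → ℤ) (sds : IsStrongDivSeq C) (p : ℕ) (prime-p : Prime p)
                     (α : ℕ → ℕ) (s : ℕ) (acc : IsAcceptable C p α s)
                     (k : ℕ) (1≤k : 1 ≤ k) (n′ r₀ : ℕ) (r₀<A : r₀ < α s) (x : ℕ) where

  open Acceptable C sds p prime-p α s acc

  n : ℕ
  n = A * n′ + r₀

  excess : ℕ → Vec ℕ k → ℕ
  excess l r = ℤ.∣ fpkC α s k l r₀ r ℤ.- ℤ.+ l ∣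

  νfall : ℕ → ℕ
  νfall l = ν p (divN (n′ !) ((n′ ∸ l) !))

  summand : ℕ → Vec ℕ k → Vec ℕ k → ℕ
  summand l r q = when (tot r ≟ r₀ + l * A)
                   (when (tot q + l ≟ n′) (x ^ excess l r * (x ^ (νfall l + l) * x ^ ν p (multinomial q))))

  n<A*[1+n′] : n < A * suc n′
  n<A*[1+n′] = ≤-trans (+-monoʳ-< (A * n′) r₀<A) (≤-reflexive (trans (+-comm (A * n′) A) (sym (*-suc A n′))))

  carry : ∀ (q r : Vec ℕ k) → All (_< A) r → tot (scaleAdd A q r) ≡ n →
          Σ ℕ λ l → l < k × tot r ≡ r₀ + l * A × tot q + l ≡ n′
  carry q r r<A tot≡n = l , l<k , tot-r≡ , tot-q+l≡
    where
    A*tot-q+tot-r≡n : A * tot q + tot r ≡ n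
    A*tot-q+tot-r≡n = trans (sym (tot-scaleAdd A q r)) tot≡n
    tot-q≤n′ : tot q ≤ n′
    tot-q≤n′ = ≤-pred (*-cancelˡ-< A (tot q) (suc n′)
                 (≤-<-trans (≤-trans (m≤m+n (A * tot q) (tot r)) (≤-reflexive A*tot-q+tot-r≡n)) n<A*[1+n′]))
    l = n′ ∸ tot q
    tot-q+l≡ : tot q + l ≡ n′
    tot-q+l≡ = m+[n∸m]≡n tot-q≤n′
    tot-r≡ : tot r ≡ r₀ + l * A
    tot-r≡ = +-cancelˡ-≡ (A * tot q) (tot r) (r₀ + l * A) (begin
      A * tot q + tot r          ≡⟨ A*tot-q+tot-r≡n ⟩
      A * n′ + r₀                ≡⟨ cong (λ z → A * z + r₀) (sym tot-q+l≡) ⟩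
      A * (tot q + l) + r₀       ≡⟨ solve 4 (λ A t l r₀ → A :* (t :+ l) :+ r₀ := A :* t :+ (r₀ :+ l :* A)) refl A (tot q) l r₀ ⟩
      A * tot q + (r₀ + l * A)   ∎)
      where open ≡-Reasoning
    l<k : l < k
    l<k = *-cancelʳ-< A l k
            (≤-<-trans (≤-trans (m≤n+m (l * A) r₀) (≤-reflexive (sym tot-r≡))) (tot<k*B A r 1≤k r<A))

  composition≡∑summand : ∀ (q r : Vec ℕ k) → All (_< A) r →
    when (tot (scaleAdd A q r) ≟ n) (x ^ ν p (multinomialC C (scaleAdd A q r))) ≡ ∑[ l < k ] summand l r q
  composition≡∑summand q r r<A with tot (scaleAdd A q r) ≟ n
  ... | no tot≢n = sym (∑-zero k (λ l _ → when-when-disjoint (tot r ≟ r₀ + l * A) (tot q + l ≟ n′) _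
                                          (λ tot-r≡ tot-q+l≡ → tot≢n (tot-scaleAdd-carry A q r tot-r≡ tot-q+l≡))))
  ... | yes tot≡n with carry q r r<A tot≡n
  ...   | l , l<k , tot-r≡ , tot-q+l≡ = sym (begin
    ∑[ i < k ] summand i r q
      ≡⟨ ∑-single k l (λ i → summand i r q) l<k (λ i _ i≢l →
           when-when-disjoint (tot r ≟ r₀ + i * A) (tot q + i ≟ n′) _
             (λ _ tot-q+i≡ → i≢l (+-cancelˡ-≡ (tot q) i l (trans tot-q+i≡ (sym tot-q+l≡))))) ⟩
    summand l r q
      ≡⟨ trans (when-yes (tot r ≟ r₀ + l * A) _ tot-r≡) (when-yes (tot q + l ≟ n′) _ tot-q+l≡) ⟩
    x ^ excess l r * (x ^ (νfall l + l) * x ^ ν p (multinomial q))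
      ≡⟨ cong (x ^ excess l r *_) (sym (^-distribˡ-+-* x (νfall l + l) _)) ⟩
    x ^ excess l r * x ^ (νfall l + l + ν p (multinomial q))
      ≡⟨ trans (sym (^-distribˡ-+-* x (excess l r) _)) (cong (x ^_) (sym (+-assoc (excess l r) _ _))) ⟩
    x ^ (excess l r + (νfall l + l) + ν p (multinomial q))
      ≡⟨ cong (x ^_) (sym (ν-multinomialC-scaleAdd n′ r₀ l q r r₀<A r<A tot-r≡ tot-q+l≡)) ⟩
    x ^ ν p (multinomialC C (scaleAdd A q r))
      ∎)
    where open ≡-Reasoning

  ∑ⱽ-summand : ∀ l r → ∑ⱽ k (suc n′) (summand l r) ≡ when (tot r ≟ r₀ + l * A) (x ^ excess l r) * Tλ p k l n′ x
  ∑ⱽ-summand l r with tot r ≟ r₀ + l * A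
  ... | no _  = ∑ⱽ-0 k (suc n′)
  ... | yes _ = begin
    ∑ⱽ k (suc n′) (λ q → when (tot q + l ≟ n′) (x ^ excess l r * (x ^ (νfall l + l) * x ^ ν p (multinomial q))))
      ≡⟨ ∑ⱽ-cong k (suc n′) (λ q _ → sym (trans (cong (x ^ excess l r *_) (when-*ˡ (tot q + l ≟ n′) (x ^ (νfall l + l)) _))
                                                 (when-*ˡ (tot q + l ≟ n′) (x ^ excess l r) _))) ⟩
    ∑ⱽ k (suc n′) (λ q → x ^ excess l r * (x ^ (νfall l + l) * when (tot q + l ≟ n′) (x ^ ν p (multinomial q))))
      ≡⟨ trans (∑ⱽ-*ˡ k (suc n′) (x ^ excess l r) _)
               (cong (x ^ excess l r *_) (∑ⱽ-*ˡ k (suc n′) (x ^ (νfall l + l)) _)) ⟩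
    x ^ excess l r * (x ^ (νfall l + l) * ∑ⱽ k (suc n′) (λ q → when (tot q + l ≟ n′) (x ^ ν p (multinomial q))))
      ≡⟨ cong (x ^ excess l r *_) (sym (Tλ≡∑ⱽ p k l n′ x)) ⟩
    x ^ excess l r * Tλ p k l n′ x
      ∎
    where open ≡-Reasoning

  u≡∑ⱽ : ∀ l → u α s k l r₀ x ≡ ∑ⱽ k A (λ r → when (tot r ≟ r₀ + l * A) (x ^ excess l r))
  u≡∑ⱽ l = trans (Σ-list-filter (λ r → tot r ≟ r₀ + l * A) (allVecs k A) (λ r → x ^ excess l r))
                 (Σ-list-allVecs k A _)

  LHS≡∑uTλ : LHS C p k n x ≡ ∑[ l < k ] (u α s k l r₀ x * Tλ p k l n′ x)
  LHS≡∑uTλ = begin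
    LHS C p k n x
      ≡⟨ Σ-list-compositions k n (A * suc n′) _ n<A*[1+n′] ⟩
    ∑ⱽ k (A * suc n′) (λ m → when (tot m ≟ n) (x ^ ν p (multinomialC C m)))
      ≡⟨ ∑ⱽ-blocks k A (suc n′) _ ⟩
    ∑ⱽ k A (λ r → ∑ⱽ k (suc n′) (λ q → when (tot (scaleAdd A q r) ≟ n) (x ^ ν p (multinomialC C (scaleAdd A q r)))))
      ≡⟨ ∑ⱽ-cong k A (λ r r<A → trans (∑ⱽ-cong k (suc n′) (λ q _ → composition≡∑summand q r r<A))
                                      (∑ⱽ-∑-comm k (suc n′) k (λ l → summand l r))) ⟩
    ∑ⱽ k A (λ r → ∑[ l < k ] ∑ⱽ k (suc n′) (summand l r))
      ≡⟨ ∑ⱽ-∑-comm k A k _ ⟩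
    ∑[ l < k ] ∑ⱽ k A (λ r → ∑ⱽ k (suc n′) (summand l r))
      ≡⟨ ∑-cong k (λ l _ → trans (∑ⱽ-cong k A (λ r _ → ∑ⱽ-summand l r)) (∑ⱽ-*ʳ k A (Tλ p k l n′ x) _)) ⟩
    ∑[ l < k ] (∑ⱽ k A (λ r → when (tot r ≟ r₀ + l * A) (x ^ excess l r)) * Tλ p k l n′ x)
      ≡⟨ ∑-cong k (λ l _ → cong (_* Tλ p k l n′ x) (sym (u≡∑ⱽ l))) ⟩
    ∑[ l < k ] (u α s k l r₀ x * Tλ p k l n′ x)
      ∎
    where open ≡-Reasoning

lemma4p2 : (C : ℕ → ℤ) → IsStrongDivSeq C →
    (p : ℕ) → Prime p → (α : ℕ → ℕ) (s : ℕ) → IsAcceptable C p α s →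
    (k : ℕ) → 2 ≤ k →
    (n n' r : ℕ) → n ≡ α s * n' + r → r < α s →
    (x : ℕ) →
    LHS C p k n x ≡ Σ-range 0 (k Data.Nat.∸ 1) (λ l → u α s k l r x * Tλ p k l n' x)
lemma4p2 C sds p prime-p α s acc k 2≤k n n' r refl r<A x = begin
  LHS C p k (α s * n' + r) x    ≡⟨ Decomposition.LHS≡∑uTλ C sds p prime-p α s acc k 1≤k n' r r<A x ⟩
  ∑ k term                      ≡⟨ cong (λ m → ∑ m term) (sym (m+[n∸m]≡n 1≤k)) ⟩
  ∑ (suc (k ∸ 1)) term          ≡⟨ sym (Σ-list-upTo (suc (k ∸ 1)) term) ⟩
  Σ-range 0 (k ∸ 1) term        ∎
  where
  open ≡-Reasoning
  1≤k : 1 ≤ k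
  1≤k = ≤-trans (s≤s z≤n) 2≤k
  term : ℕ → ℕ
  term l = u α s k l r x * Tλ p k l n' x
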